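{- Let $\mathcal{Q}$ be a finite forest poset. Then the operads $\mathsf{As}(\mathcal{Q})$ and $\mathsf{ASchr}(\mathcal{Q})$ are isomorphic.
   Context: Operads are nonsymmetric over a field $\mathbb{K}$ of characteristic zero. For a finite poset $\mathcal{Q}$ and comparable $a,b$, $a\uparrow_\mathcal{Q} b:=\min(a,b)$. $\mathsf{As}(\mathcal{Q})$ is the operad generated by binary generators $\star_a$, $a\in\mathcal{Q}$, subject to the relations $\star_a\circ_1\star_b=\star_{a\uparrow_\mathcal{Q} b}\circ_2\star_{a\uparrow_\mathcal{Q} b}$ and $\star_{a\uparrow_\mathcal{Q} b}\circ_1\star_{a\uparrow_\mathcal{Q} b}=\star_a\circ_2\star_b$ for all comparable $a,b$ (including $a=b$). A forest poset is a poset with no element lying strictly above two incomparable elements. A $\mathcal{Q}$-Schröder tree is a planar rooted tree in which each internal node has at least two children and is labeled by an element of $\mathcal{Q}$; it is $\mathcal{Q}$-alternating if for every internal node $y$ whose parent $x$ is an internal node, the labels of $x$ and $y$ are incomparable. Consider the rewrite rule on $\mathcal{Q}$-Schröder trees which, whenever an internal node labeled $a$ is a child of an internal node labeled $b$ with $a,b$ comparable, contracts the edge between them: the two nodes are replaced by a single node labeled $a\uparrow_\mathcal{Q} b$ whose children are the children of $b$ with the node $a$ replaced (in place) by the sequence of children of $a$. When $\mathcal{Q}$ is a forest poset, every $\mathcal{Q}$-Schröder tree has a unique normal form for this rule, which is $\mathcal{Q}$-alternating. $\mathsf{ASchr}(\mathcal{Q})$ is the vector space spanned by $\mathcal{Q}$-alternating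 Schröder trees, graded by number of leaves, with partial composition $\mathfrak{s}\circ_i\mathfrak{t}$ defined as the normal form of the tree obtained by grafting the root of $\mathfrak{t}$ onto the $i$-th leaf of $\mathfrak{s}$, extended linearly; the unit is the one-leaf tree. -}

module Defs where

open import Level using (Level; _⊔_) renaming (suc to lsuc)
open import Data.Nat using (ℕ; zero; suc; _+_; _∸_; _<_; _≤_; _<?_)
open import Data.Fin using (Fin)
import Data.Fin.Properties as FinP
open import Data.List using (List; []; _∷_; _++_; map; length; concatMap)
open import Data.List.Relation.Unary.All using (All)
open import Data.Product using (Σ; ∃; _×_; _,_; proj₁; proj₂)
open import Data.Sum using (_⊎_)
open import Data.Maybe using (Maybe; nothing; just)
open import Data.Bool using (if_then_else_)
open import Data.Unit using (⊤)
open import Relation.Nullary using (¬_; Dec; yes; no; does)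
open import Relation.Binary using (Rel; Decidable; IsDecPartialOrder)
open import Relation.Binary.PropositionalEquality using (_≡_; refl; cong; cong₂)
open import Algebra.Bundles using (CommutativeRing)

IsField : ∀ {c ℓ} → CommutativeRing c ℓ → Set (c ⊔ ℓ)
IsField K = (¬ (1# ≈ 0#)) × (∀ x → ¬ (x ≈ 0#) → ∃ λ y → (x * y) ≈ 1#)
  where open CommutativeRing K

natK : ∀ {c ℓ} (K : CommutativeRing c ℓ) → ℕ → CommutativeRing.Carrier K
natK K zero = CommutativeRing.0# K
natK K (suc n) = CommutativeRing._+_ K (CommutativeRing.1# K) (natK K n)

CharZero : ∀ {c ℓ} → CommutativeRing c ℓ → Set ℓ
CharZero K = ∀ n → ¬ (CommutativeRing._≈_ K (natK K (suc n)) (CommutativeRing.0# K))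

Comparable : ∀ {q ℓ'} → Rel (Fin q) ℓ' → Fin q → Fin q → Set ℓ'
Comparable _≼_ a b = (a ≼ b) ⊎ (b ≼ a)

Strict : ∀ {q ℓ'} → Rel (Fin q) ℓ' → Fin q → Fin q → Set ℓ'
Strict _≼_ a b = (a ≼ b) × ¬ (a ≡ b)

IsForestPoset : ∀ {q ℓ'} → Rel (Fin q) ℓ' → Set ℓ'
IsForestPoset _≼_ = ∀ x y z → Strict _≼_ y x → Strict _≼_ z x → Comparable _≼_ y z

module Trees (q : ℕ) where

  -- planar binary trees with internal nodes labelled (basis of the
  -- free operad on the binary generators ⋆_a, a ∈ Q)
  data BTree : Set where
    leaf : BTree
    bin  : Fin q → BTree → BTree → BTree

  arityB : BTree → ℕ
  arityB leaf = 1
  arityB (bin a l r) = arityB l + arityB r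

  -- partial composition s ∘_i t, with leaves numbered 0,1,2,... from
  -- the left (so the paper's ∘_{i+1} is graftB s i t here)
  graftB : BTree → ℕ → BTree → BTree
  graftB leaf zero t = t
  graftB leaf (suc i) t = leaf
  graftB (bin a l r) i t with i <? arityB l
  ... | yes _ = bin a (graftB l i t) r
  ... | no  _ = bin a l (graftB r (i ∸ arityB l) t)

  gen : Fin q → BTree
  gen a = bin a leaf leaf

  _≟B_ : (s t : BTree) → Dec (s ≡ t)
  leaf ≟B leaf = yes refl
  leaf ≟B bin _ _ _ = no (λ ())
  bin _ _ _ ≟B leaf = no (λ ())
  bin a l r ≟B bin b l' r' with a FinP.≟ b | l ≟B l' | r ≟B r'
  ... | yes refl | yes refl | yes refl = yes refl
  ... | no p | _ | _ = no (λ { refl → p refl })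
  ... | yes _ | no p | _ = no (λ { refl → p refl })
  ... | yes _ | yes _ | no p = no (λ { refl → p refl })

  data STree : Set where
    leaf : STree
    node : Fin q → List STree → STree

  mutual
    arityS : STree → ℕ
    arityS leaf = 1
    arityS (node a cs) = arityL cs

    arityL : List STree → ℕ
    arityL [] = 0
    arityL (c ∷ cs) = arityS c + arityL cs

  mutual
    sizeS : STree → ℕ
    sizeS leaf = 0
    sizeS (node a cs) = suc (sizeL cs)

    sizeL : List STree → ℕ
    sizeL [] = 0
    sizeL (c ∷ cs) = sizeS c + sizeL cs

  mutual
    Schroder : STree → Set
    Schroder leaf = ⊤
    Schroder (node a cs) = (2 ≤ length cs) × SchroderL cs

    SchroderL : List STree → Set
    SchroderL [] = ⊤
    SchroderL (c ∷ cs) = Schroder c × SchroderL cs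

  mutual
    graftS : STree → ℕ → STree → STree
    graftS leaf zero t = t
    graftS leaf (suc i) t = leaf
    graftS (node a cs) i t = node a (graftL cs i t)

    graftL : List STree → ℕ → STree → List STree
    graftL [] i t = []
    graftL (c ∷ cs) i t with i <? arityS c
    ... | yes _ = graftS c i t ∷ cs
    ... | no  _ = c ∷ graftL cs (i ∸ arityS c) t

  mutual
    _≟S_ : (s t : STree) → Dec (s ≡ t)
    leaf ≟S leaf = yes refl
    leaf ≟S node _ _ = no (λ ())
    node _ _ ≟S leaf = no (λ ())
    node a cs ≟S node b ds with a FinP.≟ b | cs ≟L ds
    ... | yes refl | yes refl = yes refl
    ... | no p | _ = no (λ { refl → p refl })
    ... | yes _ | no p = no (λ { refl → p refl })

    _≟L_ : (cs ds : List STree) → Dec (cs ≡ ds)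
    [] ≟L [] = yes refl
    [] ≟L (_ ∷ _) = no (λ ())
    (_ ∷ _) ≟L [] = no (λ ())
    (c ∷ cs) ≟L (d ∷ ds) with c ≟S d | cs ≟L ds
    ... | yes refl | yes refl = yes refl
    ... | no p | _ = no (λ { refl → p refl })
    ... | yes _ | no p = no (λ { refl → p refl })

module PosetTrees {q ℓ'} (_≼_ : Rel (Fin q) ℓ') (dpo : IsDecPartialOrder _≡_ _≼_) where

  open Trees q
  open IsDecPartialOrder dpo using (_≤?_)

  -- a ↑ b = min(a,b) (meaningful when a and b are comparable)
  _↑_ : Fin q → Fin q → Fin q
  a ↑ b = if does (a ≤? b) then a else b

  comparable? : (a b : Fin q) → Dec (Comparable _≼_ a b)
  comparable? a b with a ≤? b | b ≤? a
  ... | yes p | _ = yes (Data.Sum.inj₁ p)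
  ... | no _ | yes p = yes (Data.Sum.inj₂ p)
  ... | no p | no p' = no λ { (Data.Sum.inj₁ x) → p x ; (Data.Sum.inj₂ x) → p' x }

  IncompChild : Fin q → STree → Set ℓ'
  IncompChild a leaf = Level.Lift ℓ' ⊤
  IncompChild a (node b _) = ¬ Comparable _≼_ a b

  mutual
    Alternating : STree → Set ℓ'
    Alternating leaf = Level.Lift ℓ' ⊤
    Alternating (node a cs) = All (IncompChild a) cs × AlternatingL cs

    AlternatingL : List STree → Set ℓ'
    AlternatingL [] = Level.Lift ℓ' ⊤
    AlternatingL (c ∷ cs) = Alternating c × AlternatingL cs

  -- one rewrite step: contract the edge between a node labelled b and
  -- the first child node labelled a with a, b comparable.
  -- findComp b cs = just (pre , a , gs , post) when cs = pre ++ node a gs ∷ post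
  findComp : Fin q → List STree → Maybe (List STree × Fin q × List STree × List STree)
  findComp b [] = nothing
  findComp b (leaf ∷ cs) with findComp b cs
  ... | nothing = nothing
  ... | just (pre , a , gs , post) = just (leaf ∷ pre , a , gs , post)
  findComp b (node a gs ∷ cs) with comparable? a b
  ... | yes _ = just ([] , a , gs , cs)
  ... | no _ with findComp b cs
  ...   | nothing = nothing
  ...   | just (pre , a' , gs' , post) = just (node a gs ∷ pre , a' , gs' , post)

  -- repeatedly contract edges at the root (fuel bounds the number of steps;
  -- each step removes an internal node)
  absorb : ℕ → Fin q → List STree → STree
  absorb zero b cs = node b cs
  absorb (suc k) b cs with findComp b cs
  ... | nothing = node b cs
  ... | just (pre , a , gs , post) = absorb k (a ↑ b) (pre ++ gs ++ post)

  mutual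
    nf : STree → STree
    nf leaf = leaf
    nf (node b cs) = absorb (sizeL cs) b (nfL cs)

    nfL : List STree → List STree
    nfL [] = []
    nfL (c ∷ cs) = nf c ∷ nfL cs

module Linear {c ℓ} (K : CommutativeRing c ℓ) where
  open CommutativeRing K renaming (_+_ to _+K_; _*_ to _*K_)

  Lin : Set → Set c
  Lin T = List (Carrier × T)

  coeff : {T : Set} → ((s t : T) → Dec (s ≡ t)) → T → Lin T → Carrier
  coeff eq t [] = 0#
  coeff eq t ((k , s) ∷ x) = if does (eq s t) then k +K coeff eq t x else coeff eq t x

  EqLin : {T : Set} → ((s t : T) → Dec (s ≡ t)) → Lin T → Lin T → Set (c ⊔ ℓ)
  EqLin {T} eq x y = Level.Lift c (∀ (t : T) → coeff eq t x ≈ coeff eq t y)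

  zeroL : {T : Set} → Lin T
  zeroL = []

  _+L_ : {T : Set} → Lin T → Lin T → Lin T
  x +L y = x ++ y

  _•L_ : {T : Set} → Carrier → Lin T → Lin T
  k •L x = map (λ { (k' , t) → (k *K k' , t) }) x

  _-L_ : {T : Set} → Lin T → Lin T → Lin T
  x -L y = x ++ ((- 1#) •L y)

  basis : {T : Set} → T → Lin T
  basis t = (1# , t) ∷ []

  linExt : {T U : Set} → (T → Lin U) → Lin T → Lin U
  linExt f [] = []
  linExt f ((k , t) ∷ x) = (k •L f t) ++ linExt f x

  bilinExt : {T U V : Set} → (T → U → Lin V) → Lin T → Lin U → Lin V
  bilinExt f x y = linExt (λ s → linExt (λ t → f s t) y) x

  Supp : ∀ {p} {T : Set} → (T → Set p) → Lin T → Set (c ⊔ p)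
  Supp P x = All (λ kt → P (proj₂ kt)) x

module Operads {c ℓ q ℓ'} (K : CommutativeRing c ℓ)
               (_≼_ : Rel (Fin q) ℓ') (dpo : IsDecPartialOrder _≡_ _≼_) where
  open CommutativeRing K using (Carrier)
  open Trees q
  open PosetTrees _≼_ dpo
  open Linear K

  _∘F[_]_ : Lin BTree → ℕ → Lin BTree → Lin BTree
  x ∘F[ i ] y = bilinExt (λ s t → basis (graftB s i t)) x y

  ArityB : ℕ → BTree → Set
  ArityB n t = arityB t ≡ n

  -- the defining relations of As(Q), for comparable a, b:
  --   ⋆_a ∘_1 ⋆_b = ⋆_{a↑b} ∘_2 ⋆_{a↑b}
  --   ⋆_{a↑b} ∘_1 ⋆_{a↑b} = ⋆_a ∘_2 ⋆_b
  rel₁ rel₂ : Fin q → Fin q → Lin BTree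
  rel₁ a b = basis (graftB (gen a) 0 (gen b)) -L basis (graftB (gen (a ↑ b)) 1 (gen (a ↑ b)))
  rel₂ a b = basis (graftB (gen (a ↑ b)) 0 (gen (a ↑ b))) -L basis (graftB (gen a) 1 (gen b))

  data Ideal : ℕ → Lin BTree → Set (c ⊔ ℓ ⊔ ℓ') where
    rel₁∈ : ∀ a b → Comparable _≼_ a b → Ideal 3 (rel₁ a b)
    rel₂∈ : ∀ a b → Comparable _≼_ a b → Ideal 3 (rel₂ a b)
    zero∈ : ∀ {n} → Ideal n zeroL
    add∈  : ∀ {n x y} → Ideal n x → Ideal n y → Ideal n (x +L y)
    scale∈ : ∀ {n x} (k : Carrier) → Ideal n x → Ideal n (k •L x)
    resp∈ : ∀ {n x y} → EqLin _≟B_ x y → Ideal n x → Ideal n y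
    compL∈ : ∀ {n m x} (y : Lin BTree) (i : ℕ) → i < n → Supp (ArityB m) y →
             Ideal n x → Ideal (n + m ∸ 1) (x ∘F[ i ] y)
    compR∈ : ∀ {n m y} (x : Lin BTree) (i : ℕ) → i < n → Supp (ArityB n) x →
             Ideal m y → Ideal (n + m ∸ 1) (x ∘F[ i ] y)

  ASchrBasis : ℕ → STree → Set ℓ'
  ASchrBasis n t = Level.Lift ℓ' (Schroder t) × Alternating t × Level.Lift ℓ' (arityS t ≡ n)

  _∘S[_]_ : Lin STree → ℕ → Lin STree → Lin STree
  x ∘S[ i ] y = bilinExt (λ s t → basis (nf (graftS s i t))) x y

  -- An isomorphism of operads As(Q) = Free/Ideal → ASchr(Q), given by a
  -- map φ on the basis of the free operad, extended linearly, which
  --  * sends arity n to arity n,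
  --  * vanishes exactly on the ideal (well defined and injective on As(Q)),
  --  * is surjective in every arity,
  --  * preserves the unit and the partial compositions.
  record AsIsoASchr : Set (c ⊔ ℓ ⊔ Level.suc ℓ') where
    field
      φ : BTree → Lin STree
      φ-arity : ∀ t → Supp (ASchrBasis (arityB t)) (φ t)
      φ-wd : ∀ n x → Supp (ArityB n) x → Ideal n x → EqLin _≟S_ (linExt φ x) zeroL
      φ-inj : ∀ n x → Supp (ArityB n) x → EqLin _≟S_ (linExt φ x) zeroL → Ideal n x
      φ-surj : ∀ n y → Supp (ASchrBasis n) y →
               Σ (Lin BTree) λ x → Supp (ArityB n) x × EqLin _≟S_ (linExt φ x) y
      φ-unit : EqLin _≟S_ (φ leaf) (basis leaf)
      φ-comp : ∀ s i t → i < arityB s →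
               EqLin _≟S_ (φ (graftB s i t)) (φ s ∘S[ i ] φ t)

-- Orient the relations of As(Q) as edge contractions on Q-Schröder trees. A contraction removes an
-- internal node, and in a forest poset the labels below any element form a chain, so meets of
-- comparable labels commute and associate and all critical pairs join; by Newman's lemma every tree
-- has a unique normal form, which is alternating and compatible with grafting. Sending a binary tree
-- to the normal form of the Schröder tree it denotes therefore kills the relations and respects
-- composition. Conversely a Schröder tree is congruent, modulo the relations, to its resolution by
-- right combs; this gives injectivity, and resolving alternating trees gives surjectivity.

module Submission where

import Level
open import Level using (_⊔_)
open import Function using (_∘_)
open import Data.Nat using (ℕ; zero; suc; _+_; _∸_; _<_; _≤_; _<?_; z≤n; s≤s)
import Data.Nat.Properties as ℕ
open import Data.Nat.Induction using (<-wellFounded)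
open import Data.Fin using (Fin)
open import Data.Bool using (true; false)
open import Data.Maybe using (Maybe; nothing; just)
open import Data.Product using (∃-syntax; _×_; _,_; proj₂; map₂)
open import Data.Sum using (_⊎_; inj₁; inj₂; swap)
open import Data.List using (List; []; _∷_; _++_; length; map)
import Data.List.Properties as List
open import Data.List.Relation.Unary.All using (All; []; _∷_)
open import Relation.Nullary using (¬_; yes; no; does; contradiction)
open import Relation.Nullary.Decidable using (dec-false)
open import Relation.Binary using (Rel; IsDecPartialOrder; Setoid; IsEquivalence)
open import Relation.Binary.Definitions using (DecidableEquality)
open import Relation.Binary.PropositionalEquality as ≡ using (_≡_)
open import Relation.Binary.Construct.Closure.ReflexiveTransitive using (Star; ε; _◅_; _◅◅_; gmap)
open import Relation.Binary.Construct.Closure.Transitive using (Plus; [_]; _∼⁺⟨_⟩_)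
import Relation.Binary.Construct.On as On
open import Relation.Binary.Rewriting
  using (IsNormalForm; WeaklyConfluent; Confluent; StronglyNormalizing; sn&wcr⇒cr)
open import Induction.WellFounded using (module Subrelation)
open import Algebra.Bundles using (CommutativeRing)
open import Defs

m∸n<o⇒m<n+o : ∀ {m n o} → n ≤ m → m ∸ n < o → m < n + o
m∸n<o⇒m<n+o {n = n} {o} n≤m lt = ≡.subst (_< n + o) (ℕ.m+[n∸m]≡n n≤m) (ℕ.+-monoʳ-< n lt)

m<n+o⇒m∸n<o : ∀ {m n o} → n ≤ m → m < n + o → m ∸ n < o
m<n+o⇒m∸n<o {n = n} {o} n≤m lt = ℕ.+-cancelˡ-< n _ _ (≡.subst (_< n + o) (≡.sym (ℕ.m+[n∸m]≡n n≤m)) lt)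

module LinearCombinations {c ℓ} (K : CommutativeRing c ℓ) where
  open CommutativeRing K renaming (_+_ to _+K_; _*_ to _*K_)
  open Linear K
  open import Algebra.Properties.Ring ring using (-1*x≈-x)
  open import Algebra.Properties.Group +-group using (x∙y⁻¹≈ε⇒x≈y; ⁻¹-involutive)
  open import Algebra.Properties.CommutativeSemigroup +-commutativeSemigroup
    using (interchange; x∙yz≈y∙xz)
  open import Algebra.Properties.CommutativeSemigroup *-commutativeSemigroup
    using () renaming (x∙yz≈y∙xz to x*[y*z]≈y*[x*z])
  open import Relation.Binary.Reasoning.Setoid setoid

  -- Coefficients of x -L y are of this form, since _-L_ scales y by - 1#.
  infixl 6 _−_
  _−_ : Carrier → Carrier → Carrier
  a − b = a +K - 1# *K b

  x−x≈0 : ∀ a → a − a ≈ 0#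
  x−x≈0 a = trans (+-congˡ (-1*x≈-x a)) (-‿inverseʳ a)

  x−y≈0⇒x≈y : ∀ a b → a − b ≈ 0# → a ≈ b
  x−y≈0⇒x≈y a b h = x∙y⁻¹≈ε⇒x≈y a b (trans (+-congˡ (sym (-1*x≈-x b))) h)

  -1*[x−y]≈y−x : ∀ a b → - 1# *K (a − b) ≈ b − a
  -1*[x−y]≈y−x a b = begin
    - 1# *K (a − b)                    ≈⟨ distribˡ (- 1#) a _ ⟩
    - 1# *K a +K - 1# *K (- 1# *K b)   ≈⟨ +-congˡ (trans (-1*x≈-x _) (trans (-‿cong (-1*x≈-x b))
                                                                          (⁻¹-involutive b))) ⟩
    - 1# *K a +K b                     ≈⟨ +-comm _ b ⟩
    b − a                              ∎

  [x−y]+[y−z]≈x−z : ∀ a b d → (a − b) +K (b − d) ≈ a − d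
  [x−y]+[y−z]≈x−z a b d = begin
    (a − b) +K (b − d)                   ≈⟨ interchange a _ b _ ⟩
    (a +K b) +K (- 1# *K b +K - 1# *K d) ≈⟨ +-assoc a b _ ⟩
    a +K (b +K (- 1# *K b +K - 1# *K d)) ≈⟨ +-congˡ (sym (+-assoc b _ _)) ⟩
    a +K ((b − b) +K - 1# *K d)          ≈⟨ +-congˡ (+-congʳ (x−x≈0 b)) ⟩
    a +K (0# +K - 1# *K d)               ≈⟨ +-congˡ (+-identityˡ _) ⟩
    a − d                                ∎

  pairing : {T : Set} → (T → Carrier) → Lin T → Carrier
  pairing F [] = 0#
  pairing F ((k , s) ∷ x) = k *K F s +K pairing F x

  pairing-++ : ∀ {T : Set} (F : T → Carrier) x y → pairing F (x ++ y) ≈ pairing F x +K pairing F y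
  pairing-++ F [] y = sym (+-identityˡ _)
  pairing-++ F ((k , s) ∷ x) y = trans (+-congˡ (pairing-++ F x y)) (sym (+-assoc _ _ _))

  pairing-• : ∀ {T : Set} (F : T → Carrier) k x → pairing F (k •L x) ≈ k *K pairing F x
  pairing-• F k [] = sym (zeroʳ k)
  pairing-• F k ((k′ , s) ∷ x) = trans (+-cong (*-assoc k k′ _) (pairing-• F k x)) (sym (distribˡ k _ _))

  linExt-++ : ∀ {S T : Set} (f : S → Lin T) x y → linExt f (x ++ y) ≡ linExt f x ++ linExt f y
  linExt-++ f [] y = ≡.refl
  linExt-++ f ((k , s) ∷ x) y =
    ≡.trans (≡.cong (k •L f s ++_) (linExt-++ f x y)) (≡.sym (List.++-assoc (k •L f s) _ _))

  •-++ : ∀ {T : Set} k (x y : Lin T) → k •L (x ++ y) ≡ k •L x ++ k •L y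
  •-++ k x y = List.map-++ _ x y

  linExt-const-[] : ∀ {S T : Set} (x : Lin S) → linExt {U = T} (λ _ → []) x ≡ []
  linExt-const-[] [] = ≡.refl
  linExt-const-[] (_ ∷ x) = linExt-const-[] x

  pairing-congˡ : ∀ {T : Set} {F G : T → Carrier} → (∀ s → F s ≈ G s) → ∀ x → pairing F x ≈ pairing G x
  pairing-congˡ F≈G [] = refl
  pairing-congˡ F≈G ((k , s) ∷ x) = +-cong (*-congˡ (F≈G s)) (pairing-congˡ F≈G x)

  pairing-minus-pointwise : ∀ {T : Set} (F G : T → Carrier) x →
                            pairing (λ s → F s − G s) x ≈ pairing F x − pairing G x
  pairing-minus-pointwise F G [] = sym (trans (+-identityˡ _) (zeroʳ _))
  pairing-minus-pointwise F G ((k , s) ∷ x) = begin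
    k *K (F s − G s) +K pairing (λ s → F s − G s) x
      ≈⟨ +-cong (distribˡ k _ _) (pairing-minus-pointwise F G x) ⟩
    (k *K F s +K k *K (- 1# *K G s)) +K (pairing F x − pairing G x)
      ≈⟨ +-congʳ (+-congˡ (x*[y*z]≈y*[x*z] k _ _)) ⟩
    (k *K F s − k *K G s) +K (pairing F x − pairing G x)
      ≈⟨ interchange _ _ _ _ ⟩
    (k *K F s +K pairing F x) +K (- 1# *K (k *K G s) +K - 1# *K pairing G x)
      ≈⟨ +-congˡ (distribˡ (- 1#) _ _) ⟨
    (k *K F s +K pairing F x) − (k *K G s +K pairing G x)  ∎

  module Coefficients {T : Set} (_≟_ : DecidableEquality T) where

    infix 4 _≋_
    record _≋_ (x y : Lin T) : Set (c ⊔ ℓ) where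
      constructor coeffwise
      field coeff-≈ : ∀ t → coeff _≟_ t x ≈ coeff _≟_ t y
    open _≋_ public

    toEqLin : ∀ {x y} → x ≋ y → EqLin _≟_ x y
    toEqLin (coeffwise h) = Level.lift h

    fromEqLin : ∀ {x y} → EqLin _≟_ x y → x ≋ y
    fromEqLin (Level.lift h) = coeffwise h

    ≋-isEquivalence : IsEquivalence _≋_
    ≋-isEquivalence = record
      { refl  = coeffwise λ _ → refl
      ; sym   = λ (coeffwise h) → coeffwise λ t → sym (h t)
      ; trans = λ (coeffwise h) (coeffwise h′) → coeffwise λ t → trans (h t) (h′ t)
      }

    ≋-setoid : Setoid c (c ⊔ ℓ)
    ≋-setoid = record { isEquivalence = ≋-isEquivalence }

    open IsEquivalence ≋-isEquivalence public
      using () renaming (refl to ≋-refl; reflexive to ≋-reflexive; sym to ≋-sym; trans to ≋-trans)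

    coeff-++ : ∀ t x y → coeff _≟_ t (x ++ y) ≈ coeff _≟_ t x +K coeff _≟_ t y
    coeff-++ t [] y = sym (+-identityˡ _)
    coeff-++ t ((k , s) ∷ x) y with does (s ≟ t)
    ... | true  = trans (+-congˡ (coeff-++ t x y)) (sym (+-assoc _ _ _))
    ... | false = coeff-++ t x y

    coeff-• : ∀ t k x → coeff _≟_ t (k •L x) ≈ k *K coeff _≟_ t x
    coeff-• t k [] = sym (zeroʳ k)
    coeff-• t k ((k′ , s) ∷ x) with does (s ≟ t)
    ... | true  = trans (+-congˡ (coeff-• t k x)) (sym (distribˡ k k′ _))
    ... | false = coeff-• t k x

    coeff-minus : ∀ t x y → coeff _≟_ t (x -L y) ≈ coeff _≟_ t x − coeff _≟_ t y
    coeff-minus t x y = trans (coeff-++ t x _) (+-congˡ (coeff-• t (- 1#) y))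

    ++-cong : ∀ {x x′ y y′} → x ≋ x′ → y ≋ y′ → x ++ y ≋ x′ ++ y′
    ++-cong {x} {x′} {y} {y′} (coeffwise h) (coeffwise h′) = coeffwise λ t →
      trans (coeff-++ t x y) (trans (+-cong (h t) (h′ t)) (sym (coeff-++ t x′ y′)))

    •-cong : ∀ k {x y} → x ≋ y → k •L x ≋ k •L y
    •-cong k {x} {y} (coeffwise h) = coeffwise λ t →
      trans (coeff-• t k x) (trans (*-congˡ (h t)) (sym (coeff-• t k y)))

    •-assoc : ∀ k k′ x → (k *K k′) •L x ≋ k •L (k′ •L x)
    •-assoc k k′ x = coeffwise λ t → begin
      coeff _≟_ t ((k *K k′) •L x)  ≈⟨ coeff-• t _ x ⟩
      (k *K k′) *K coeff _≟_ t x    ≈⟨ *-assoc k k′ _ ⟩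
      k *K (k′ *K coeff _≟_ t x)    ≈⟨ *-congˡ (coeff-• t k′ x) ⟨
      k *K coeff _≟_ t (k′ •L x)    ≈⟨ coeff-• t k (k′ •L x) ⟨
      coeff _≟_ t (k •L (k′ •L x))  ∎

    •-identity : ∀ x → 1# •L x ≋ x
    •-identity x = coeffwise λ t → trans (coeff-• t 1# x) (*-identityˡ _)

    •-basis : ∀ k t → k •L basis t ≋ (k , t) ∷ []
    •-basis k t = coeffwise λ u → head u
      where
      head : ∀ u → coeff _≟_ u ((k *K 1# , t) ∷ []) ≈ coeff _≟_ u ((k , t) ∷ [])
      head u with does (t ≟ u)
      ... | true  = +-congʳ (*-identityʳ k)
      ... | false = refl

    minus-self : ∀ x → x -L x ≋ []
    minus-self x = coeffwise λ t → trans (coeff-minus t x x) (x−x≈0 _)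

    minus-swap : ∀ x y → (- 1#) •L (x -L y) ≋ y -L x
    minus-swap x y = coeffwise λ t → begin
      coeff _≟_ t ((- 1#) •L (x -L y))             ≈⟨ coeff-• t _ (x -L y) ⟩
      - 1# *K coeff _≟_ t (x -L y)                 ≈⟨ *-congˡ (coeff-minus t x y) ⟩
      - 1# *K (coeff _≟_ t x − coeff _≟_ t y)      ≈⟨ -1*[x−y]≈y−x _ _ ⟩
      coeff _≟_ t y − coeff _≟_ t x                ≈⟨ coeff-minus t y x ⟨
      coeff _≟_ t (y -L x)                         ∎

    minus-trans : ∀ x y z → (x -L y) ++ (y -L z) ≋ x -L z
    minus-trans x y z = coeffwise λ t → begin
      coeff _≟_ t ((x -L y) ++ (y -L z))                              ≈⟨ coeff-++ t (x -L y) _ ⟩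
      coeff _≟_ t (x -L y) +K coeff _≟_ t (y -L z)                    ≈⟨ +-cong (coeff-minus t x y) (coeff-minus t y z) ⟩
      (coeff _≟_ t x − coeff _≟_ t y) +K (coeff _≟_ t y − coeff _≟_ t z) ≈⟨ [x−y]+[y−z]≈x−z _ _ _ ⟩
      coeff _≟_ t x − coeff _≟_ t z                                   ≈⟨ coeff-minus t x z ⟨
      coeff _≟_ t (x -L z)                                            ∎

    removeAll : T → Lin T → Lin T
    removeAll s [] = []
    removeAll s ((k , t) ∷ x) with t ≟ s
    ... | yes _ = removeAll s x
    ... | no  _ = (k , t) ∷ removeAll s x

    length-removeAll : ∀ s x → length (removeAll s x) ≤ length x
    length-removeAll s [] = z≤n
    length-removeAll s ((k , t) ∷ x) with t ≟ s
    ... | yes _ = ℕ.m≤n⇒m≤1+n (length-removeAll s x)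
    ... | no  _ = s≤s (length-removeAll s x)

    coeff-removeAll-self : ∀ s x → coeff _≟_ s (removeAll s x) ≈ 0#
    coeff-removeAll-self s [] = refl
    coeff-removeAll-self s ((k , t) ∷ x) with t ≟ s
    ... | yes _  = coeff-removeAll-self s x
    ... | no t≢s rewrite dec-false (t ≟ s) t≢s = coeff-removeAll-self s x

    coeff-removeAll-other : ∀ s u x → ¬ s ≡ u → coeff _≟_ u (removeAll s x) ≈ coeff _≟_ u x
    coeff-removeAll-other s u [] _ = refl
    coeff-removeAll-other s u ((k , t) ∷ x) s≢u with t ≟ s
    ... | yes ≡.refl rewrite dec-false (t ≟ u) s≢u = coeff-removeAll-other s u x s≢u
    ... | no _ with does (t ≟ u)
    ...   | true  = +-congˡ (coeff-removeAll-other s u x s≢u)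
    ...   | false = coeff-removeAll-other s u x s≢u

    pairing-removeAll : ∀ F s x → pairing F x ≈ pairing F (removeAll s x) +K coeff _≟_ s x *K F s
    pairing-removeAll F s [] = sym (trans (+-identityˡ _) (zeroˡ _))
    pairing-removeAll F s ((k , t) ∷ x) with t ≟ s
    ... | yes ≡.refl = begin
      k *K F t +K pairing F x                                          ≈⟨ +-congˡ (pairing-removeAll F t x) ⟩
      k *K F t +K (pairing F (removeAll t x) +K coeff _≟_ t x *K F t)  ≈⟨ x∙yz≈y∙xz _ _ _ ⟩
      pairing F (removeAll t x) +K (k *K F t +K coeff _≟_ t x *K F t)  ≈⟨ +-congˡ (distribʳ (F t) k _) ⟨
      pairing F (removeAll t x) +K (k +K coeff _≟_ t x) *K F t         ∎
    ... | no _ = trans (+-congˡ (pairing-removeAll F s x)) (sym (+-assoc _ _ _))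

    removeAll-null : ∀ s {x} → x ≋ [] → removeAll s x ≋ []
    removeAll-null s {x} (coeffwise h) = coeffwise λ u → coeff-removeAll u
      where
      coeff-removeAll : ∀ u → coeff _≟_ u (removeAll s x) ≈ 0#
      coeff-removeAll u with s ≟ u
      ... | yes ≡.refl = coeff-removeAll-self s x
      ... | no s≢u     = trans (coeff-removeAll-other s u x s≢u) (h u)

    length-removeAll-head : ∀ k s x → length (removeAll s ((k , s) ∷ x)) ≤ length x
    length-removeAll-head k s x with s ≟ s
    ... | yes _  = length-removeAll s x
    ... | no s≢s = contradiction ≡.refl s≢s

    pairing-null : ∀ F x → x ≋ [] → pairing F x ≈ 0#
    pairing-null F x = go (length x) x ℕ.≤-refl
      where
      go : ∀ n x → length x ≤ n → x ≋ [] → pairing F x ≈ 0#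
      go _       []                _           _    = refl
      go (suc n) y@((k , s) ∷ x) (s≤s |x|≤n) y≋[] = begin
        pairing F y                                        ≈⟨ pairing-removeAll F s y ⟩
        pairing F (removeAll s y) +K coeff _≟_ s y *K F s  ≈⟨ +-cong rest (*-congʳ (coeff-≈ y≋[] s)) ⟩
        0# +K 0# *K F s                                    ≈⟨ trans (+-identityˡ _) (zeroˡ _) ⟩
        0#                                                 ∎
        where
        rest : pairing F (removeAll s y) ≈ 0#
        rest = go n _ (ℕ.≤-trans (length-removeAll-head k s x) |x|≤n) (removeAll-null s y≋[])

    pairing-cong : ∀ F {x y} → x ≋ y → pairing F x ≈ pairing F y
    pairing-cong F {x} {y} (coeffwise h) = x−y≈0⇒x≈y _ _ (begin
      pairing F x − pairing F y               ≈⟨ +-congˡ (pairing-• F (- 1#) y) ⟨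
      pairing F x +K pairing F ((- 1#) •L y)  ≈⟨ pairing-++ F x _ ⟨
      pairing F (x -L y)                      ≈⟨ pairing-null F (x -L y) x-y≋[] ⟩
      0#                                      ∎)
      where
      x-y≋[] : x -L y ≋ []
      x-y≋[] = coeffwise λ t → trans (coeff-minus t x y) (trans (+-congˡ (*-congˡ (sym (h t)))) (x−x≈0 _))

    coeff-linExt : ∀ {S : Set} t (f : S → Lin T) x →
                   coeff _≟_ t (linExt f x) ≈ pairing (λ s → coeff _≟_ t (f s)) x
    coeff-linExt t f [] = refl
    coeff-linExt t f ((k , s) ∷ x) =
      trans (coeff-++ t (k •L f s) _) (+-cong (coeff-• t k (f s)) (coeff-linExt t f x))

    module _ {S : Set} where

      linExt-• : ∀ (f : S → Lin T) k x → linExt f (k •L x) ≋ k •L linExt f x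
      linExt-• f k [] = ≋-refl
      linExt-• f k ((k′ , s) ∷ x) rewrite •-++ k (k′ •L f s) (linExt f x) =
        ++-cong (•-assoc k k′ (f s)) (linExt-• f k x)

      linExt-basis : ∀ (f : S → Lin T) s → linExt f (basis s) ≋ f s
      linExt-basis f s rewrite List.++-identityʳ (1# •L f s) = •-identity (f s)

      linExt-minus : ∀ (f : S → Lin T) x y → linExt f (x -L y) ≋ linExt f x -L linExt f y
      linExt-minus f x y rewrite linExt-++ f x ((- 1#) •L y) = ++-cong ≋-refl (linExt-• f (- 1#) y)

      linExt-congˡ : ∀ {f g : S → Lin T} → (∀ s → f s ≋ g s) → ∀ x → linExt f x ≋ linExt g x
      linExt-congˡ f≋g [] = ≋-refl
      linExt-congˡ f≋g ((k , s) ∷ x) = ++-cong (•-cong k (f≋g s)) (linExt-congˡ f≋g x)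

      linExt-minus-pointwise : ∀ (f g : S → Lin T) x →
                               linExt (λ s → f s -L g s) x ≋ linExt f x -L linExt g x
      linExt-minus-pointwise f g x = coeffwise λ t → begin
        coeff _≟_ t (linExt (λ s → f s -L g s) x)                         ≈⟨ coeff-linExt t _ x ⟩
        pairing (λ s → coeff _≟_ t (f s -L g s)) x                        ≈⟨ pairing-congˡ (λ s → coeff-minus t (f s) (g s)) x ⟩
        pairing (λ s → coeff _≟_ t (f s) − coeff _≟_ t (g s)) x           ≈⟨ pairing-minus-pointwise _ _ x ⟩
        pairing (λ s → coeff _≟_ t (f s)) x − pairing (λ s → coeff _≟_ t (g s)) x
          ≈⟨ +-cong (coeff-linExt t f x) (*-congˡ (coeff-linExt t g x)) ⟨
        coeff _≟_ t (linExt f x) − coeff _≟_ t (linExt g x)               ≈⟨ coeff-minus t (linExt f x) _ ⟨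
        coeff _≟_ t (linExt f x -L linExt g x)                            ∎

    linExt-minus-basis : ∀ {S : Set} (f : S → Lin T) s s′ → linExt f (basis s -L basis s′) ≋ f s -L f s′
    linExt-minus-basis f s s′ =
      ≋-trans (linExt-minus f (basis s) (basis s′)) (++-cong (linExt-basis f s) (•-cong (- 1#) (linExt-basis f s′)))

    linExt-∘ : ∀ {R S : Set} (g : S → Lin T) (f : R → Lin S) x →
               linExt g (linExt f x) ≋ linExt (λ r → linExt g (f r)) x
    linExt-∘ g f [] = ≋-refl
    linExt-∘ g f ((k , r) ∷ x) rewrite linExt-++ g (k •L f r) (linExt f x) =
      ++-cong (linExt-• g k (f r)) (linExt-∘ g f x)

    linExt-∘-basis : ∀ {R S : Set} (g : S → Lin T) (h : R → S) x →
                     linExt g (linExt (λ r → basis (h r)) x) ≋ linExt (λ r → g (h r)) x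
    linExt-∘-basis g h x = ≋-trans (linExt-∘ g _ x) (linExt-congˡ (λ r → linExt-basis g (h r)) x)

    linExt-basis-id : ∀ x → linExt basis x ≋ x
    linExt-basis-id [] = ≋-refl
    linExt-basis-id ((k , t) ∷ x) = ++-cong (•-basis k t) (linExt-basis-id x)

  module LinearMaps {S T : Set} (_≟S_ : DecidableEquality S) (_≟T_ : DecidableEquality T) where
    private
      module S = Coefficients _≟S_
      module T = Coefficients _≟T_

    linExt-congʳ : ∀ (f : S → Lin T) {x y} → x S.≋ y → linExt f x T.≋ linExt f y
    linExt-congʳ f {x} {y} x≋y = T.coeffwise λ t →
      trans (T.coeff-linExt t f x) (trans (S.pairing-cong _ x≋y) (sym (T.coeff-linExt t f y)))

module Minimum {q ℓ'} (_≼_ : Rel (Fin q) ℓ') (dpo : IsDecPartialOrder _≡_ _≼_) where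
  open PosetTrees _≼_ dpo using (_↑_)
  open IsDecPartialOrder dpo using (_≤?_; antisym) renaming (refl to ≼-refl; trans to ≼-trans)
  open ≡ using (refl)

  Cmp : Fin q → Fin q → Set ℓ'
  Cmp = Comparable _≼_

  x≼y⇒x↑y≡x : ∀ {a b} → a ≼ b → a ↑ b ≡ a
  x≼y⇒x↑y≡x {a} {b} a≼b with a ≤? b
  ... | yes _  = refl
  ... | no a⋠b = contradiction a≼b a⋠b

  y≼x⇒x↑y≡y : ∀ {a b} → b ≼ a → a ↑ b ≡ b
  y≼x⇒x↑y≡y {a} {b} b≼a with a ≤? b
  ... | yes a≼b = antisym a≼b b≼a
  ... | no _    = refl

  ↑-idem : ∀ a → a ↑ a ≡ a
  ↑-idem a = x≼y⇒x↑y≡x ≼-refl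

  ↑-comm : ∀ {a b} → Cmp a b → a ↑ b ≡ b ↑ a
  ↑-comm (inj₁ a≼b) = ≡.trans (x≼y⇒x↑y≡x a≼b) (≡.sym (y≼x⇒x↑y≡y a≼b))
  ↑-comm (inj₂ b≼a) = ≡.trans (y≼x⇒x↑y≡y b≼a) (≡.sym (x≼y⇒x↑y≡x b≼a))

  ↑-≼ˡ : ∀ {a b} → Cmp a b → (a ↑ b) ≼ a
  ↑-≼ˡ (inj₁ a≼b) rewrite x≼y⇒x↑y≡x a≼b = ≼-refl
  ↑-≼ˡ (inj₂ b≼a) rewrite y≼x⇒x↑y≡y b≼a = b≼a

  ↑-≼ʳ : ∀ {a b} → Cmp a b → (a ↑ b) ≼ b
  ↑-≼ʳ (inj₁ a≼b) rewrite x≼y⇒x↑y≡x a≼b = a≼b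
  ↑-≼ʳ (inj₂ b≼a) rewrite y≼x⇒x↑y≡y b≼a = ≼-refl

  ↑-greatest : ∀ {a b w} → w ≼ a → w ≼ b → w ≼ (a ↑ b)
  ↑-greatest {a} {b} w≼a w≼b with a ≤? b
  ... | yes _ = w≼a
  ... | no _  = w≼b

  ↑-Cmpʳ : ∀ {a b} → Cmp a b → Cmp (a ↑ b) b
  ↑-Cmpʳ a~b = inj₁ (↑-≼ʳ a~b)

  ↑-lowerBounds : ∀ {a b w} → Cmp a b → w ≼ (a ↑ b) → w ≼ a × w ≼ b
  ↑-lowerBounds a~b w≼ = ≼-trans w≼ (↑-≼ˡ a~b) , ≼-trans w≼ (↑-≼ʳ a~b)

  ↑-absorbˡ : ∀ {a b} → Cmp a b → (a ↑ b) ↑ b ≡ a ↑ b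
  ↑-absorbˡ c = x≼y⇒x↑y≡x (↑-≼ʳ c)

  ↑-absorbʳ : ∀ {a b} → Cmp a b → b ↑ (a ↑ b) ≡ a ↑ b
  ↑-absorbʳ c = y≼x⇒x↑y≡y (↑-≼ʳ c)

  ≡-byLowerBounds : ∀ {u v} → (∀ {w} → w ≼ u → w ≼ v) → (∀ {w} → w ≼ v → w ≼ u) → u ≡ v
  ≡-byLowerBounds u≤v v≤u = antisym (u≤v ≼-refl) (v≤u ≼-refl)

module ForestMinimum {q ℓ'} (_≼_ : Rel (Fin q) ℓ') (dpo : IsDecPartialOrder _≡_ _≼_)
                     (forest : IsForestPoset _≼_) where
  open PosetTrees _≼_ dpo using (_↑_)
  open Minimum _≼_ dpo
  open IsDecPartialOrder dpo using () renaming (trans to ≼-trans)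
  import Data.Fin.Properties as Fin

  -- The one use of the forest axiom: two elements strictly below z are comparable.
  Cmp-↑ : ∀ {x y z} → Cmp x z → Cmp y z → Cmp x (y ↑ z)
  Cmp-↑ x~z (inj₂ z≼y) rewrite y≼x⇒x↑y≡y z≼y = x~z
  Cmp-↑ (inj₂ z≼x) (inj₁ y≼z) rewrite x≼y⇒x↑y≡x y≼z = inj₂ (≼-trans y≼z z≼x)
  Cmp-↑ {x} {y} {z} (inj₁ x≼z) (inj₁ y≼z) rewrite x≼y⇒x↑y≡x y≼z with x Fin.≟ z | y Fin.≟ z
  ... | yes ≡.refl | _          = inj₂ y≼z
  ... | no _       | yes ≡.refl = inj₁ x≼z
  ... | no x≢z     | no y≢z     = forest z x y (x≼z , x≢z) (y≼z , y≢z)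

  Cmp-↑-below : ∀ {a b d} → Cmp d a → Cmp a b → Cmp d (a ↑ b)
  Cmp-↑-below d~a a~b = ≡.subst (Cmp _) (↑-comm (swap a~b)) (Cmp-↑ d~a (swap a~b))

  Cmp-↑-above : ∀ {a b d} → Cmp d a → Cmp a b → Cmp (d ↑ a) b
  Cmp-↑-above d~a a~b = swap (Cmp-↑ (swap a~b) d~a)

  ↑-leftComm : ∀ {a d b} → Cmp a b → Cmp d b → d ↑ (a ↑ b) ≡ a ↑ (d ↑ b)
  ↑-leftComm a~b d~b = ≡-byLowerBounds
    (λ w≼ → let w≼d , w≼ab = ↑-lowerBounds (Cmp-↑ d~b a~b) w≼ ; w≼a , w≼b = ↑-lowerBounds a~b w≼ab
            in ↑-greatest w≼a (↑-greatest w≼d w≼b))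
    (λ w≼ → let w≼a , w≼db = ↑-lowerBounds (Cmp-↑ a~b d~b) w≼ ; w≼d , w≼b = ↑-lowerBounds d~b w≼db
            in ↑-greatest w≼d (↑-greatest w≼a w≼b))

  ↑-assoc : ∀ {a b d} → Cmp a b → Cmp d a → d ↑ (a ↑ b) ≡ (d ↑ a) ↑ b
  ↑-assoc a~b d~a = ≡-byLowerBounds
    (λ w≼ → let w≼d , w≼ab = ↑-lowerBounds (Cmp-↑-below d~a a~b) w≼ ; w≼a , w≼b = ↑-lowerBounds a~b w≼ab
            in ↑-greatest (↑-greatest w≼d w≼a) w≼b)
    (λ w≼ → let w≼da , w≼b = ↑-lowerBounds (Cmp-↑-above d~a a~b) w≼ ; w≼d , w≼a = ↑-lowerBounds d~a w≼da
            in ↑-greatest w≼d (↑-greatest w≼a w≼b))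

module Contraction {q ℓ'} (_≼_ : Rel (Fin q) ℓ') (dpo : IsDecPartialOrder _≡_ _≼_) where
  open Trees q
  open PosetTrees _≼_ dpo
  open Minimum _≼_ dpo using (Cmp)
  open ≡ using (refl; cong; subst)

  data Splice : List STree → Fin q → List STree → Set where
    here  : ∀ {a gs cs} → Splice (node a gs ∷ cs) a (gs ++ cs)
    there : ∀ {c cs a cs′} → Splice cs a cs′ → Splice (c ∷ cs) a (c ∷ cs′)

  infix 4 _⇒_ _⇒ᴸ_ _⇒*_ _⇒ᴸ*_
  mutual
    data _⇒_ : STree → STree → Set ℓ' where
      contract : ∀ {b cs a cs′} → Splice cs a cs′ → Cmp a b → node b cs ⇒ node (a ↑ b) cs′
      inside   : ∀ {b cs cs′} → cs ⇒ᴸ cs′ → node b cs ⇒ node b cs′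

    data _⇒ᴸ_ : List STree → List STree → Set ℓ' where
      here  : ∀ {c c′ cs} → c ⇒ c′ → c ∷ cs ⇒ᴸ c′ ∷ cs
      there : ∀ {c cs cs′} → cs ⇒ᴸ cs′ → c ∷ cs ⇒ᴸ c ∷ cs′

  _⇒*_ : Rel STree ℓ'
  _⇒*_ = Star _⇒_

  _⇒ᴸ*_ : Rel (List STree) ℓ'
  _⇒ᴸ*_ = Star _⇒ᴸ_

  splice-view : ∀ {cs a cs′} → Splice cs a cs′ →
                ∃[ pre ] ∃[ gs ] ∃[ post ] cs ≡ pre ++ node a gs ∷ post × cs′ ≡ pre ++ gs ++ post
  splice-view (here {gs = gs} {cs = post}) = [] , gs , post , refl , refl
  splice-view (there {c} sp) with splice-view sp
  ... | pre , gs , post , refl , refl = c ∷ pre , gs , post , refl , refl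

  splice-++ˡ : ∀ pre {cs a cs′} → Splice cs a cs′ → Splice (pre ++ cs) a (pre ++ cs′)
  splice-++ˡ []        sp = sp
  splice-++ˡ (_ ∷ pre) sp = there (splice-++ˡ pre sp)

  splice-++ʳ : ∀ post {cs a cs′} → Splice cs a cs′ → Splice (cs ++ post) a (cs′ ++ post)
  splice-++ʳ post (here {gs = gs} {cs = cs}) rewrite List.++-assoc gs cs post = here
  splice-++ʳ post (there sp) = there (splice-++ʳ post sp)

  ⇒ᴸ-++ˡ : ∀ pre {cs cs′} → cs ⇒ᴸ cs′ → pre ++ cs ⇒ᴸ pre ++ cs′
  ⇒ᴸ-++ˡ []        st = st
  ⇒ᴸ-++ˡ (_ ∷ pre) st = there (⇒ᴸ-++ˡ pre st)

  ⇒ᴸ-++ʳ : ∀ post {cs cs′} → cs ⇒ᴸ cs′ → cs ++ post ⇒ᴸ cs′ ++ post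
  ⇒ᴸ-++ʳ post (here st)  = here st
  ⇒ᴸ-++ʳ post (there st) = there (⇒ᴸ-++ʳ post st)

  splice-diamond : ∀ {cs a₁ cs₁ a₂ cs₂} → Splice cs a₁ cs₁ → Splice cs a₂ cs₂ →
                   (a₁ ≡ a₂ × cs₁ ≡ cs₂) ⊎ ∃[ L ] Splice cs₁ a₂ L × Splice cs₂ a₁ L
  splice-diamond here               here               = inj₁ (refl , refl)
  splice-diamond (here {gs = gs})   (there sp)         = inj₂ (_ , splice-++ˡ gs sp , here)
  splice-diamond (there sp)         (here {gs = gs})   = inj₂ (_ , here , splice-++ˡ gs sp)
  splice-diamond (there sp₁)        (there sp₂) with splice-diamond sp₁ sp₂
  ... | inj₁ (refl , refl)     = inj₁ (refl , refl)
  ... | inj₂ (_ , sp₂′ , sp₁′) = inj₂ (_ , there sp₂′ , there sp₁′)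

  splice-⇒ᴸ : ∀ {cs a cs′ cs″} → Splice cs a cs′ → cs ⇒ᴸ cs″ →
              (∃[ L ] Splice cs″ a L × cs′ ⇒ᴸ L) ⊎
              (∃[ L ] ∃[ d ] Cmp d a × Splice cs′ d L × Splice cs″ (d ↑ a) L)
  splice-⇒ᴸ (here {cs = post}) (here (contract sp d~a)) = inj₂ (_ , _ , d~a , splice-++ʳ post sp , here)
  splice-⇒ᴸ (here {cs = post}) (here (inside st))       = inj₁ (_ , here , ⇒ᴸ-++ʳ post st)
  splice-⇒ᴸ (here {gs = gs})   (there st)               = inj₁ (_ , here , ⇒ᴸ-++ˡ gs st)
  splice-⇒ᴸ (there sp)         (here st)                = inj₁ (_ , there sp , here st)
  splice-⇒ᴸ (there sp)         (there st) with splice-⇒ᴸ sp st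
  ... | inj₁ (_ , sp″ , st′)           = inj₁ (_ , there sp″ , there st′)
  ... | inj₂ (_ , _ , d~a , sp′ , sp″) = inj₂ (_ , _ , d~a , there sp′ , there sp″)

  contract-≡ : ∀ {b cs a cs′ m} → Splice cs a cs′ → Cmp a b → a ↑ b ≡ m → node b cs ⇒ node m cs′
  contract-≡ sp a~b refl = contract sp a~b

  sizeL-++ : ∀ xs ys → sizeL (xs ++ ys) ≡ sizeL xs + sizeL ys
  sizeL-++ []       ys = refl
  sizeL-++ (x ∷ xs) ys = ≡.trans (cong (sizeS x +_) (sizeL-++ xs ys)) (≡.sym (ℕ.+-assoc (sizeS x) _ _))

  splice-size : ∀ {cs a cs′} → Splice cs a cs′ → sizeL cs ≡ suc (sizeL cs′)
  splice-size (here {gs = gs} {cs = cs}) = cong suc (≡.sym (sizeL-++ gs cs))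
  splice-size (there {c} sp) = ≡.trans (cong (sizeS c +_) (splice-size sp)) (ℕ.+-suc (sizeS c) _)

  mutual
    ⇒-size : ∀ {X Y} → X ⇒ Y → sizeS X ≡ suc (sizeS Y)
    ⇒-size (contract sp _) = cong suc (splice-size sp)
    ⇒-size (inside st)     = cong suc (⇒ᴸ-size st)

    ⇒ᴸ-size : ∀ {cs cs′} → cs ⇒ᴸ cs′ → sizeL cs ≡ suc (sizeL cs′)
    ⇒ᴸ-size (here st)      = cong (_+ _) (⇒-size st)
    ⇒ᴸ-size (there {c} st) = ≡.trans (cong (sizeS c +_) (⇒ᴸ-size st)) (ℕ.+-suc (sizeS c) _)

  ⇒ᴸ*-size : ∀ {cs cs′} → cs ⇒ᴸ* cs′ → sizeL cs′ ≤ sizeL cs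
  ⇒ᴸ*-size ε          = ℕ.≤-refl
  ⇒ᴸ*-size (st ◅ sts) rewrite ⇒ᴸ-size st = ℕ.m≤n⇒m≤1+n (⇒ᴸ*-size sts)

  arityL-++ : ∀ xs ys → arityL (xs ++ ys) ≡ arityL xs + arityL ys
  arityL-++ []       ys = refl
  arityL-++ (x ∷ xs) ys = ≡.trans (cong (arityS x +_) (arityL-++ xs ys)) (≡.sym (ℕ.+-assoc (arityS x) _ _))

  splice-arity : ∀ {cs a cs′} → Splice cs a cs′ → arityL cs ≡ arityL cs′
  splice-arity (here {gs = gs} {cs = cs}) = ≡.sym (arityL-++ gs cs)
  splice-arity (there {c} sp) = cong (arityS c +_) (splice-arity sp)

  mutual
    ⇒-arity : ∀ {X Y} → X ⇒ Y → arityS X ≡ arityS Y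
    ⇒-arity (contract sp _) = splice-arity sp
    ⇒-arity (inside st)     = ⇒ᴸ-arity st

    ⇒ᴸ-arity : ∀ {cs cs′} → cs ⇒ᴸ cs′ → arityL cs ≡ arityL cs′
    ⇒ᴸ-arity (here st)      = cong (_+ _) (⇒-arity st)
    ⇒ᴸ-arity (there {c} st) = cong (arityS c +_) (⇒ᴸ-arity st)

  ⇒*-arity : ∀ {X Y} → X ⇒* Y → arityS X ≡ arityS Y
  ⇒*-arity ε          = refl
  ⇒*-arity (st ◅ sts) = ≡.trans (⇒-arity st) (⇒*-arity sts)

  SchroderL-++ : ∀ xs ys → SchroderL xs → SchroderL ys → SchroderL (xs ++ ys)
  SchroderL-++ []       ys _          sys = sys
  SchroderL-++ (x ∷ xs) ys (sx , sxs) sys = sx , SchroderL-++ xs ys sxs sys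

  -- The spliced node has at least two children.
  splice-Schroder : ∀ {cs a cs′} → Splice cs a cs′ → SchroderL cs → length cs ≤ length cs′ × SchroderL cs′
  splice-Schroder (here {gs = gs} {cs = cs}) ((2≤|gs| , sgs) , scs) =
    subst (suc (length cs) ≤_) (≡.sym (List.length-++ gs))
          (ℕ.+-monoˡ-≤ (length cs) (ℕ.≤-trans (s≤s z≤n) 2≤|gs|)) ,
    SchroderL-++ gs cs sgs scs
  splice-Schroder (there sp) (sc , scs) =
    let |cs|≤|cs′| , scs′ = splice-Schroder sp scs in s≤s |cs|≤|cs′| , sc , scs′

  mutual
    ⇒-Schroder : ∀ {X Y} → X ⇒ Y → Schroder X → Schroder Y
    ⇒-Schroder (contract sp _) (2≤ , scs) =
      let |cs|≤|cs′| , scs′ = splice-Schroder sp scs in ℕ.≤-trans 2≤ |cs|≤|cs′| , scs′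
    ⇒-Schroder (inside st) (2≤ , scs) =
      let |cs|≡|cs′| , scs′ = ⇒ᴸ-Schroder st scs in subst (2 ≤_) |cs|≡|cs′| 2≤ , scs′

    ⇒ᴸ-Schroder : ∀ {cs cs′} → cs ⇒ᴸ cs′ → SchroderL cs → length cs ≡ length cs′ × SchroderL cs′
    ⇒ᴸ-Schroder (here st)  (sc , scs) = refl , ⇒-Schroder st sc , scs
    ⇒ᴸ-Schroder (there st) (sc , scs) =
      let |cs|≡|cs′| , scs′ = ⇒ᴸ-Schroder st scs in cong suc |cs|≡|cs′| , sc , scs′

  ⇒*-Schroder : ∀ {X Y} → X ⇒* Y → Schroder X → Schroder Y
  ⇒*-Schroder ε          sX = sX
  ⇒*-Schroder (st ◅ sts) sX = ⇒*-Schroder sts (⇒-Schroder st sX)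

  AlternatingL-++ : ∀ xs ys → AlternatingL xs → AlternatingL ys → AlternatingL (xs ++ ys)
  AlternatingL-++ []       ys _          ays = ays
  AlternatingL-++ (x ∷ xs) ys (ax , axs) ays = ax , AlternatingL-++ xs ys axs ays

  splice-AlternatingL : ∀ {cs a cs′} → Splice cs a cs′ → AlternatingL cs → AlternatingL cs′
  splice-AlternatingL (here {gs = gs} {cs = cs}) ((_ , ags) , acs) = AlternatingL-++ gs cs ags acs
  splice-AlternatingL (there sp) (ac , acs) = ac , splice-AlternatingL sp acs

  splice-incomparable : ∀ {b cs a cs′} → Splice cs a cs′ → All (IncompChild b) cs → ¬ Cmp a b
  splice-incomparable here       (b≁a ∷ _) a~b = b≁a (swap a~b)
  splice-incomparable (there sp) (_ ∷ inc) a~b = splice-incomparable sp inc a~b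

  mutual
    Alternating⇒normal : ∀ {X} → Alternating X → IsNormalForm _⇒_ X
    Alternating⇒normal (inc , _)   (_ , contract sp a~b) = splice-incomparable sp inc a~b
    Alternating⇒normal (_ , altcs) (_ , inside st)       = AlternatingL⇒normal altcs (_ , st)

    AlternatingL⇒normal : ∀ {cs} → AlternatingL cs → IsNormalForm _⇒ᴸ_ cs
    AlternatingL⇒normal (ac , _)   (_ , here st)  = Alternating⇒normal ac (_ , st)
    AlternatingL⇒normal (_ , acs)  (_ , there st) = AlternatingL⇒normal acs (_ , st)

  FindCompSpec : Fin q → List STree → Maybe (List STree × Fin q × List STree × List STree) → Set ℓ'
  FindCompSpec b cs nothing                       = All (IncompChild b) cs
  FindCompSpec b cs (just (pre , a , gs , post)) = Splice cs a (pre ++ gs ++ post) × Cmp a b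

  findComp-correct : ∀ b cs → FindCompSpec b cs (findComp b cs)
  findComp-correct b [] = []
  findComp-correct b (leaf ∷ cs) with findComp b cs | findComp-correct b cs
  ... | nothing | inc       = _ ∷ inc
  ... | just _  | sp , a~b = there sp , a~b
  findComp-correct b (node a gs ∷ cs) with comparable? a b
  ... | yes a~b = here , a~b
  ... | no a≁b with findComp b cs | findComp-correct b cs
  ...   | nothing | inc      = (λ b~a → a≁b (swap b~a)) ∷ inc
  ...   | just _  | sp , a~b = there sp , a~b

  absorb-⇒* : ∀ k b cs → node b cs ⇒* absorb k b cs
  absorb-⇒* zero    b cs = ε
  absorb-⇒* (suc k) b cs with findComp b cs | findComp-correct b cs
  ... | nothing                    | _        = ε
  ... | just (pre , a , gs , post) | sp , a~b = contract sp a~b ◅ absorb-⇒* k (a ↑ b) (pre ++ gs ++ post)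

  mutual
    ⇒*-nf : ∀ X → X ⇒* nf X
    ⇒*-nf leaf        = ε
    ⇒*-nf (node b cs) = gmap (node b) inside (⇒ᴸ*-nfL cs) ◅◅ absorb-⇒* (sizeL cs) b (nfL cs)

    ⇒ᴸ*-nfL : ∀ cs → cs ⇒ᴸ* nfL cs
    ⇒ᴸ*-nfL []       = ε
    ⇒ᴸ*-nfL (c ∷ cs) = gmap (_∷ cs) here (⇒*-nf c) ◅◅ gmap (nf c ∷_) there (⇒ᴸ*-nfL cs)

  -- The fuel of absorb suffices: each contraction removes an internal node, and with no internal
  -- node left among the children there is nothing comparable to absorb.
  absorb-Alternating : ∀ k b cs → AlternatingL cs → sizeL cs ≤ k → Alternating (absorb k b cs)
  absorb-Alternating zero b cs acs sz≤0 = leaves-incomparable cs (ℕ.n≤0⇒n≡0 sz≤0) , acs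
    where
    leaves-incomparable : ∀ cs → sizeL cs ≡ 0 → All (IncompChild b) cs
    leaves-incomparable []          _ = []
    leaves-incomparable (leaf ∷ cs) e = _ ∷ leaves-incomparable cs e
  absorb-Alternating (suc k) b cs acs sz≤ with findComp b cs | findComp-correct b cs
  ... | nothing | inc      = inc , acs
  ... | just _  | sp , _ = absorb-Alternating k _ _ (splice-AlternatingL sp acs)
                             (ℕ.≤-pred (subst (_≤ suc k) (splice-size sp) sz≤))

  mutual
    nf-Alternating : ∀ X → Alternating (nf X)
    nf-Alternating leaf        = _
    nf-Alternating (node b cs) = absorb-Alternating (sizeL cs) b (nfL cs) (nfL-AlternatingL cs) (⇒ᴸ*-size (⇒ᴸ*-nfL cs))

    nfL-AlternatingL : ∀ cs → AlternatingL (nfL cs)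
    nfL-AlternatingL []       = _
    nfL-AlternatingL (c ∷ cs) = nf-Alternating c , nfL-AlternatingL cs

  graftL-++-< : ∀ xs ys i t → i < arityL xs → graftL (xs ++ ys) i t ≡ graftL xs i t ++ ys
  graftL-++-< []       ys i t ()
  graftL-++-< (c ∷ xs) ys i t i< with i <? arityS c
  ... | yes _ = refl
  ... | no i≮c = cong (c ∷_) (graftL-++-< xs ys (i ∸ arityS c) t (m<n+o⇒m∸n<o (ℕ.≮⇒≥ i≮c) i<))

  graftL-++-≮ : ∀ xs ys i t → ¬ i < arityL xs → graftL (xs ++ ys) i t ≡ xs ++ graftL ys (i ∸ arityL xs) t
  graftL-++-≮ []       ys i t _ = refl
  graftL-++-≮ (c ∷ xs) ys i t i≮ with i <? arityS c
  ... | yes i<c = contradiction (ℕ.<-≤-trans i<c (ℕ.m≤m+n (arityS c) (arityL xs))) i≮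
  ... | no i≮c rewrite graftL-++-≮ xs ys (i ∸ arityS c) t (i≮ ∘ m∸n<o⇒m<n+o (ℕ.≮⇒≥ i≮c))
                     | ℕ.∸-+-assoc i (arityS c) (arityL xs) = refl

  splice-graftL : ∀ {cs a cs′} i t → Splice cs a cs′ → Splice (graftL cs i t) a (graftL cs′ i t)
  splice-graftL i t (here {gs = gs} {cs = cs}) with i <? arityL gs
  ... | yes i< rewrite graftL-++-< gs cs i t i< = here
  ... | no i≮  rewrite graftL-++-≮ gs cs i t i≮ = here
  splice-graftL i t (there {c} sp) with i <? arityS c
  ... | yes _ = there sp
  ... | no _  = there (splice-graftL _ t sp)

  mutual
    graftS-⇒ˡ : ∀ {X Y} i t → X ⇒ Y → graftS X i t ⇒ graftS Y i t
    graftS-⇒ˡ i t (contract sp a~b) = contract (splice-graftL i t sp) a~b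
    graftS-⇒ˡ i t (inside st)       = inside (graftL-⇒ᴸˡ i t st)

    graftL-⇒ᴸˡ : ∀ {cs cs′} i t → cs ⇒ᴸ cs′ → graftL cs i t ⇒ᴸ graftL cs′ i t
    graftL-⇒ᴸˡ i t (here {c} {c′} {cs} st) with i <? arityS c | i <? arityS c′
    ... | yes _  | yes _   = here (graftS-⇒ˡ i t st)
    ... | no _   | no _    rewrite ⇒-arity st = here st
    ... | yes i< | no i≮′  = contradiction (subst (i <_) (⇒-arity st) i<) i≮′
    ... | no i≮  | yes i<′ = contradiction (subst (i <_) (≡.sym (⇒-arity st)) i<′) i≮
    graftL-⇒ᴸˡ i t (there {c} st) with i <? arityS c
    ... | yes _ = there st
    ... | no _  = there (graftL-⇒ᴸˡ _ t st)

  mutual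
    graftS-⇒ʳ : ∀ X i {t t′} → t ⇒ t′ → graftS X i t ⇒* graftS X i t′
    graftS-⇒ʳ leaf        zero    st = st ◅ ε
    graftS-⇒ʳ leaf        (suc i) st = ε
    graftS-⇒ʳ (node b cs) i       st = gmap (node b) inside (graftL-⇒ʳ cs i st)

    graftL-⇒ʳ : ∀ cs i {t t′} → t ⇒ t′ → graftL cs i t ⇒ᴸ* graftL cs i t′
    graftL-⇒ʳ []       i st = ε
    graftL-⇒ʳ (c ∷ cs) i st with i <? arityS c
    ... | yes _ = gmap (_∷ cs) here (graftS-⇒ʳ c i st)
    ... | no _  = gmap (c ∷_) there (graftL-⇒ʳ cs _ st)

  graftS-⇒* : ∀ {X Y t t′} i → X ⇒* Y → t ⇒* t′ → graftS X i t ⇒* graftS Y i t′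
  graftS-⇒* {Y = Y} i X⇒*Y t⇒*t′ = gmap _ (graftS-⇒ˡ i _) X⇒*Y ◅◅ right t⇒*t′
    where
    right : ∀ {t t′} → t ⇒* t′ → graftS Y i t ⇒* graftS Y i t′
    right ε          = ε
    right (st ◅ sts) = graftS-⇒ʳ Y i st ◅◅ right sts

module Confluence {q ℓ'} (_≼_ : Rel (Fin q) ℓ') (dpo : IsDecPartialOrder _≡_ _≼_)
                  (forest : IsForestPoset _≼_) where
  open Trees q
  open PosetTrees _≼_ dpo
  open Minimum _≼_ dpo
  open ForestMinimum _≼_ dpo forest
  open Contraction _≼_ dpo
  open ≡ using (refl)

  mutual
    ⇒-weaklyConfluent : WeaklyConfluent _⇒_
    ⇒-weaklyConfluent (contract sp₁ a₁~b) (contract sp₂ a₂~b) with splice-diamond sp₁ sp₂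
    ... | inj₁ (refl , refl)     = _ , ε , ε
    ... | inj₂ (_ , sp₂′ , sp₁′) =
      _ , contract sp₂′ (Cmp-↑ a₂~b a₁~b) ◅ ε ,
          contract-≡ sp₁′ (Cmp-↑ a₁~b a₂~b) (≡.sym (↑-leftComm a₁~b a₂~b)) ◅ ε
    ⇒-weaklyConfluent (contract sp a~b) (inside st) = contract-inside-joinable sp a~b st
    ⇒-weaklyConfluent (inside st) (contract sp a~b) =
      let W , l , r = contract-inside-joinable sp a~b st in W , r , l
    ⇒-weaklyConfluent (inside st₁) (inside st₂) =
      let L , l , r = ⇒ᴸ-weaklyConfluent st₁ st₂ in _ , gmap _ inside l , gmap _ inside r

    contract-inside-joinable : ∀ {b cs a cs′ cs″} → Splice cs a cs′ → Cmp a b → cs ⇒ᴸ cs″ →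
                               ∃[ W ] node (a ↑ b) cs′ ⇒* W × node b cs″ ⇒* W
    contract-inside-joinable sp a~b st with splice-⇒ᴸ sp st
    ... | inj₁ (_ , sp″ , st′) = _ , inside st′ ◅ ε , contract sp″ a~b ◅ ε
    ... | inj₂ (_ , _ , d~a , sp′ , sp″) =
      _ , contract sp′ (Cmp-↑-below d~a a~b) ◅ ε ,
          contract-≡ sp″ (Cmp-↑-above d~a a~b) (≡.sym (↑-assoc a~b d~a)) ◅ ε

    ⇒ᴸ-weaklyConfluent : WeaklyConfluent _⇒ᴸ_
    ⇒ᴸ-weaklyConfluent (here st₁) (here st₂) =
      let W , l , r = ⇒-weaklyConfluent st₁ st₂ in _ , gmap _ here l , gmap _ here r
    ⇒ᴸ-weaklyConfluent (here st₁)  (there st₂) = _ , there st₂ ◅ ε , here st₁ ◅ ε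
    ⇒ᴸ-weaklyConfluent (there st₁) (here st₂)  = _ , here st₂ ◅ ε , there st₁ ◅ ε
    ⇒ᴸ-weaklyConfluent (there st₁) (there st₂) =
      let L , l , r = ⇒ᴸ-weaklyConfluent st₁ st₂ in _ , gmap _ there l , gmap _ there r

  ⇒⁺-size : ∀ {X Y} → Plus _⇒_ X Y → sizeS Y < sizeS X
  ⇒⁺-size [ st ] rewrite ⇒-size st = ℕ.n<1+n _
  ⇒⁺-size (_ ∼⁺⟨ X⇒⁺Y ⟩ Y⇒⁺Z) = ℕ.<-trans (⇒⁺-size Y⇒⁺Z) (⇒⁺-size X⇒⁺Y)

  ⇒-stronglyNormalizing : StronglyNormalizing (Plus _⇒_)
  ⇒-stronglyNormalizing =
    Subrelation.wellFounded ⇒⁺-size (On.wellFounded sizeS <-wellFounded)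

  ⇒-confluent : Confluent _⇒_
  ⇒-confluent = sn&wcr⇒cr ⇒-stronglyNormalizing ⇒-weaklyConfluent

  normalForm-unique : ∀ {X N₁ N₂} → X ⇒* N₁ → X ⇒* N₂ →
                      IsNormalForm _⇒_ N₁ → IsNormalForm _⇒_ N₂ → N₁ ≡ N₂
  normalForm-unique X⇒*N₁ X⇒*N₂ nf₁ nf₂ with ⇒-confluent X⇒*N₁ X⇒*N₂
  ... | _ , ε        , ε        = refl
  ... | _ , st ◅ _   , _        = contradiction (_ , st) nf₁
  ... | _ , ε        , st ◅ _   = contradiction (_ , st) nf₂

  nf-normal : ∀ X → IsNormalForm _⇒_ (nf X)
  nf-normal X = Alternating⇒normal (nf-Alternating X)

  nf-⇒* : ∀ {X Y} → X ⇒* Y → nf X ≡ nf Y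
  nf-⇒* {X} {Y} X⇒*Y = normalForm-unique (⇒*-nf X) (X⇒*Y ◅◅ ⇒*-nf Y) (nf-normal X) (nf-normal Y)

  nf-Alternating-id : ∀ {X} → Alternating X → nf X ≡ X
  nf-Alternating-id {X} altX = normalForm-unique (⇒*-nf X) ε (nf-normal X) (Alternating⇒normal altX)

  nf-graftS : ∀ X i Y → nf (graftS X i Y) ≡ nf (graftS (nf X) i (nf Y))
  nf-graftS X i Y = nf-⇒* (graftS-⇒* i (⇒*-nf X) (⇒*-nf Y))

module Presentation {c ℓ q ℓ'} (K : CommutativeRing c ℓ)
                    (_≼_ : Rel (Fin q) ℓ') (dpo : IsDecPartialOrder _≡_ _≼_) where
  open CommutativeRing K using (-_; 1#)
  open Trees q
  open PosetTrees _≼_ dpo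
  open Linear K
  open Operads K _≼_ dpo
  open LinearCombinations K
  open Coefficients _≟B_
  open Minimum _≼_ dpo
  open ≡ using (refl; cong; subst)
  open import Algebra.Properties.CommutativeSemigroup ℕ.+-commutativeSemigroup using (xy∙z≈xz∙y)

  Ideal-cast : ∀ {n n′ x} → n ≡ n′ → Ideal n x → Ideal n′ x
  Ideal-cast refl x∈I = x∈I

  Ideal-resp : ∀ {n x y} → x ≋ y → Ideal n x → Ideal n y
  Ideal-resp x≋y = resp∈ (toEqLin x≋y)

  infix 4 _∼_
  _∼_ : Rel BTree (c ⊔ ℓ ⊔ ℓ')
  s ∼ t = arityB s ≡ arityB t × Ideal (arityB s) (basis s -L basis t)

  ∼-refl : ∀ {t} → t ∼ t
  ∼-refl {t} = refl , Ideal-resp (≋-sym (minus-self (basis t))) zero∈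

  ∼-sym : ∀ {s t} → s ∼ t → t ∼ s
  ∼-sym {s} {t} (s≡t , s-t∈I) =
    ≡.sym s≡t , Ideal-cast s≡t (Ideal-resp (minus-swap (basis s) (basis t)) (scale∈ (- 1#) s-t∈I))

  ∼-trans : ∀ {s t u} → s ∼ t → t ∼ u → s ∼ u
  ∼-trans {s} {t} {u} (s≡t , s-t∈I) (t≡u , t-u∈I) =
    ≡.trans s≡t t≡u ,
    Ideal-resp (minus-trans (basis s) (basis t) (basis u)) (add∈ s-t∈I (Ideal-cast (≡.sym s≡t) t-u∈I))

  arityB-graftB : ∀ s i t → i < arityB s → suc (arityB (graftB s i t)) ≡ arityB s + arityB t
  arityB-graftB leaf zero t _ = refl
  arityB-graftB leaf (suc i) t (s≤s ())
  arityB-graftB (bin a l r) i t i< with i <? arityB l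
  ... | yes i<l = ≡.trans (cong (_+ arityB r) (arityB-graftB l i t i<l)) (xy∙z≈xz∙y (arityB l) _ _)
  ... | no i≮l  = begin
    suc (arityB l + arityB (graftB r (i ∸ arityB l) t))  ≡⟨ ℕ.+-suc (arityB l) _ ⟨
    arityB l + suc (arityB (graftB r (i ∸ arityB l) t))  ≡⟨ cong (arityB l +_)
                                                              (arityB-graftB r _ t (m<n+o⇒m∸n<o (ℕ.≮⇒≥ i≮l) i<)) ⟩
    arityB l + (arityB r + arityB t)                      ≡⟨ ℕ.+-assoc (arityB l) _ _ ⟨
    arityB l + arityB r + arityB t                        ∎
    where open ≡.≡-Reasoning

  graftB-minus : ∀ {s s′} i t →
                 (basis s -L basis s′) ∘F[ i ] basis t ≋ basis (graftB s i t) -L basis (graftB s′ i t)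
  graftB-minus {s} {s′} i t =
    ≋-trans (linExt-congˡ (λ u → linExt-basis (λ v → basis (graftB u i v)) t) (basis s -L basis s′))
            (linExt-minus-basis (λ u → basis (graftB u i t)) s s′)

  ∼-graftˡ : ∀ {s s′} i t → i < arityB s → s ∼ s′ → graftB s i t ∼ graftB s′ i t
  ∼-graftˡ {s} {s′} i t i< (s≡s′ , s-s′∈I) =
    ℕ.suc-injective (≡.trans (arityB-graftB s i t i<)
                      (≡.trans (cong (_+ arityB t) s≡s′) (≡.sym (arityB-graftB s′ i t (subst (i <_) s≡s′ i<))))) ,
    Ideal-cast (cong (_∸ 1) (≡.sym (arityB-graftB s i t i<)))
      (Ideal-resp (graftB-minus {s} {s′} i t) (compL∈ (basis t) i i< (refl ∷ []) s-s′∈I))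

  ∼-graftʳ : ∀ s i {t t′} → i < arityB s → t ∼ t′ → graftB s i t ∼ graftB s i t′
  ∼-graftʳ s i {t} {t′} i< (t≡t′ , t-t′∈I) =
    ℕ.suc-injective (≡.trans (arityB-graftB s i t i<)
                      (≡.trans (cong (arityB s +_) t≡t′) (≡.sym (arityB-graftB s i t′ i<)))) ,
    Ideal-cast (cong (_∸ 1) (≡.sym (arityB-graftB s i t i<)))
      (Ideal-resp (linExt-minus-basis-∘ s) (compR∈ (basis s) i i< (refl ∷ []) t-t′∈I))
    where
    linExt-minus-basis-∘ : ∀ s → basis s ∘F[ i ] (basis t -L basis t′) ≋
                                 basis (graftB s i t) -L basis (graftB s i t′)
    linExt-minus-basis-∘ s =
      ≋-trans (linExt-basis (λ u → linExt (λ v → basis (graftB u i v)) (basis t -L basis t′)) s)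
              (linExt-minus-basis (λ v → basis (graftB s i v)) t t′)

  bin-congˡ : ∀ a {u u′} w → u ∼ u′ → bin a u w ∼ bin a u′ w
  bin-congˡ a w = ∼-graftʳ (bin a leaf w) 0 (s≤s z≤n)

  bin-congʳ : ∀ a w {u u′} → u ∼ u′ → bin a w u ∼ bin a w u′
  bin-congʳ a w u∼u′ = ∼-graftˡ 0 w (s≤s z≤n) (∼-graftʳ (gen a) 1 (s≤s (s≤s z≤n)) u∼u′)

  rel₁-∼ : ∀ {x y} l m r → Cmp x y → bin x (bin y l m) r ∼ bin (x ↑ y) l (bin (x ↑ y) m r)
  rel₁-∼ {x} {y} l m r x~y =
    ∼-graftˡ 0 l (s≤s z≤n) (∼-graftˡ 1 m (s≤s (s≤s z≤n))
      (∼-graftˡ 2 r (s≤s (s≤s (s≤s z≤n))) (refl , rel₁∈ x y x~y)))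

  rel₂-∼ : ∀ {x y} l m r → Cmp x y → bin (x ↑ y) (bin (x ↑ y) l m) r ∼ bin x l (bin y m r)
  rel₂-∼ {x} {y} l m r x~y =
    ∼-graftˡ 0 l (s≤s z≤n) (∼-graftˡ 1 m (s≤s (s≤s z≤n))
      (∼-graftˡ 2 r (s≤s (s≤s (s≤s z≤n))) (refl , rel₂∈ x y x~y)))

  assoc-∼ : ∀ z l m r → bin z (bin z l m) r ∼ bin z l (bin z m r)
  assoc-∼ z l m r =
    subst (λ w → bin z (bin z l m) r ∼ bin w l (bin w m r)) (↑-idem z) (rel₁-∼ l m r (inj₁ ≼-refl))
    where open IsDecPartialOrder dpo using () renaming (refl to ≼-refl)

  relabel-∼ : ∀ {x y} l m r → Cmp x y → bin x l (bin y m r) ∼ bin (x ↑ y) l (bin (x ↑ y) m r)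
  relabel-∼ l m r x~y = ∼-trans (∼-sym (rel₂-∼ l m r x~y)) (assoc-∼ _ l m r)

  comb : Fin q → List BTree → BTree
  comb a []           = leaf
  comb a (x ∷ [])     = x
  comb a (x ∷ y ∷ xs) = bin a x (comb a (y ∷ xs))

  bin-combʳ : ∀ {x y} w ys → Cmp x y → 2 ≤ length ys → bin x w (comb y ys) ∼ comb (x ↑ y) (w ∷ ys)
  bin-combʳ w (_ ∷ [])            _   (s≤s ())
  bin-combʳ w (y₁ ∷ y₂ ∷ [])      x~y _ = relabel-∼ w y₁ y₂ x~y
  bin-combʳ {x} {y} w (y₁ ∷ y₂ ∷ y₃ ∷ ys) x~y _ =
    ∼-trans (relabel-∼ w y₁ _ x~y) (bin-congʳ (x ↑ y) w
      (subst (λ z → bin (x ↑ y) y₁ (comb y (y₂ ∷ y₃ ∷ ys)) ∼ comb z (y₁ ∷ y₂ ∷ y₃ ∷ ys)) (↑-absorbˡ x~y)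
             (bin-combʳ y₁ (y₂ ∷ y₃ ∷ ys) (↑-Cmpʳ x~y) (s≤s (s≤s z≤n)))))

  bin-combˡ : ∀ {x y} ys w → Cmp x y → 2 ≤ length ys → bin x (comb y ys) w ∼ comb (x ↑ y) (ys ++ w ∷ [])
  bin-combˡ (_ ∷ [])            _ _   (s≤s ())
  bin-combˡ (y₁ ∷ y₂ ∷ [])      w x~y _ = rel₁-∼ y₁ y₂ w x~y
  bin-combˡ {x} {y} (y₁ ∷ y₂ ∷ y₃ ∷ ys) w x~y _ =
    ∼-trans (rel₁-∼ y₁ _ w x~y) (bin-congʳ (x ↑ y) y₁
      (subst (λ z → bin (x ↑ y) (comb y (y₂ ∷ y₃ ∷ ys)) w ∼ comb z (y₂ ∷ y₃ ∷ ys ++ w ∷ [])) (↑-absorbˡ x~y)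
             (bin-combˡ (y₂ ∷ y₃ ∷ ys) w (↑-Cmpʳ x~y) (s≤s (s≤s z≤n)))))

  comb-flattenLast : ∀ {a b} x xs ys → Cmp a b → 1 ≤ length ys →
                     comb (a ↑ b) (x ∷ xs ++ comb b ys ∷ []) ∼ comb (a ↑ b) (x ∷ xs ++ ys)
  comb-flattenLast x [] (y ∷ []) a~b _ = ∼-refl
  comb-flattenLast {a} {b} x [] (y₁ ∷ y₂ ∷ ys) a~b _ =
    subst (λ z → bin (a ↑ b) x (comb b (y₁ ∷ y₂ ∷ ys)) ∼ comb z (x ∷ y₁ ∷ y₂ ∷ ys)) (↑-absorbˡ a~b)
          (bin-combʳ x (y₁ ∷ y₂ ∷ ys) (↑-Cmpʳ a~b) (s≤s (s≤s z≤n)))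
  comb-flattenLast {a} {b} x (x′ ∷ xs) ys a~b 1≤ = bin-congʳ (a ↑ b) x (comb-flattenLast x′ xs ys a~b 1≤)

  bin-comb-↑ : ∀ {a b} p ys → Cmp a b → 2 ≤ length ys → bin b p (comb (a ↑ b) ys) ∼ comb (a ↑ b) (p ∷ ys)
  bin-comb-↑ {a} {b} p ys a~b 2≤ =
    subst (λ z → bin b p (comb (a ↑ b) ys) ∼ comb z (p ∷ ys)) (↑-absorbʳ a~b)
          (bin-combʳ p ys (swap (↑-Cmpʳ a~b)) 2≤)

  comb-splice : ∀ {a b} → Cmp a b → ∀ P G Q → 2 ≤ length G → 2 ≤ length (P ++ comb a G ∷ Q) →
                comb b (P ++ comb a G ∷ Q) ∼ comb (a ↑ b) (P ++ G ++ Q)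
  comb-splice a~b [] G [] _ (s≤s ())
  comb-splice {a} {b} a~b [] (g ∷ gs) (q ∷ qs) 2≤G _ =
    ∼-trans (subst (λ z → bin b (comb a (g ∷ gs)) (comb b (q ∷ qs)) ∼ comb z (g ∷ gs ++ comb b (q ∷ qs) ∷ []))
                   (↑-comm (swap a~b)) (bin-combˡ (g ∷ gs) _ (swap a~b) 2≤G))
            (comb-flattenLast g gs (q ∷ qs) a~b (s≤s z≤n))
  comb-splice {a} {b} a~b (p ∷ []) G [] 2≤G _ rewrite List.++-identityʳ G =
    subst (λ z → bin b p (comb a G) ∼ comb z (p ∷ G)) (↑-comm (swap a~b)) (bin-combʳ p G (swap a~b) 2≤G)
  comb-splice {a} {b} a~b (p ∷ []) G (q ∷ qs) 2≤G _ =
    ∼-trans (bin-congʳ b p (comb-splice a~b [] G (q ∷ qs) 2≤G (s≤s (s≤s z≤n))))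
            (bin-comb-↑ p (G ++ q ∷ qs) a~b (ℕ.≤-trans 2≤G (List.length-++-≤ˡ G)))
  comb-splice {a} {b} a~b (p ∷ p′ ∷ ps) G Q 2≤G _ =
    ∼-trans (bin-congʳ b p (comb-splice a~b (p′ ∷ ps) G Q 2≤G
                             (s≤s (ℕ.≤-trans (s≤s z≤n) (List.length-++-≤ʳ (comb a G ∷ Q) {ps})))))
            (bin-comb-↑ p (p′ ∷ ps ++ G ++ Q) a~b
               (ℕ.≤-trans 2≤G (ℕ.≤-trans (List.length-++-≤ˡ G) (List.length-++-≤ʳ (G ++ Q) {p′ ∷ ps}))))

  open Contraction _≼_ dpo

  mutual
    resolution : STree → BTree
    resolution leaf        = leaf
    resolution (node a cs) = comb a (resolutions cs)

    resolutions : List STree → List BTree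
    resolutions []       = []
    resolutions (c ∷ cs) = resolution c ∷ resolutions cs

  resolutions-++ : ∀ xs ys → resolutions (xs ++ ys) ≡ resolutions xs ++ resolutions ys
  resolutions-++ []       ys = refl
  resolutions-++ (x ∷ xs) ys = cong (resolution x ∷_) (resolutions-++ xs ys)

  length-resolutions : ∀ xs → length (resolutions xs) ≡ length xs
  length-resolutions []       = refl
  length-resolutions (x ∷ xs) = cong suc (length-resolutions xs)

  SchroderL-middle : ∀ pre a gs post → SchroderL (pre ++ node a gs ∷ post) → 2 ≤ length gs
  SchroderL-middle []        a gs post ((2≤ , _) , _) = 2≤
  SchroderL-middle (_ ∷ pre) a gs post (_ , spre)     = SchroderL-middle pre a gs post spre

  mutual
    ⇒-resolution : ∀ {X Y} → X ⇒ Y → Schroder X → resolution X ∼ resolution Y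
    ⇒-resolution (contract {b} {a = a} sp a~b) (2≤ , scs) with splice-view sp
    ... | pre , gs , post , refl , refl
      rewrite resolutions-++ pre (node a gs ∷ post) | resolutions-++ pre (gs ++ post) | resolutions-++ gs post =
      comb-splice a~b (resolutions pre) (resolutions gs) (resolutions post)
        (subst (2 ≤_) (≡.sym (length-resolutions gs)) (SchroderL-middle pre a gs post scs))
        (subst (2 ≤_) (≡.trans (≡.sym (length-resolutions (pre ++ node a gs ∷ post)))
                               (cong length (resolutions-++ pre (node a gs ∷ post)))) 2≤)
    ⇒-resolution (inside {b} st) (_ , scs) = ⇒ᴸ-comb b st scs

    ⇒ᴸ-comb : ∀ b {cs cs′} → cs ⇒ᴸ cs′ → SchroderL cs →
              comb b (resolutions cs) ∼ comb b (resolutions cs′)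
    ⇒ᴸ-comb b (here {cs = []} st)    (sc , _)  = ⇒-resolution st sc
    ⇒ᴸ-comb b (here {cs = _ ∷ _} st) (sc , _)  = bin-congˡ b _ (⇒-resolution st sc)
    ⇒ᴸ-comb b (there {c} st@(here _))  (_ , scs) = bin-congʳ b (resolution c) (⇒ᴸ-comb b st scs)
    ⇒ᴸ-comb b (there {c} st@(there _)) (_ , scs) = bin-congʳ b (resolution c) (⇒ᴸ-comb b st scs)

  ⇒*-resolution : ∀ {X Y} → X ⇒* Y → Schroder X → resolution X ∼ resolution Y
  ⇒*-resolution ε          _  = ∼-refl
  ⇒*-resolution (st ◅ sts) sX = ∼-trans (⇒-resolution st sX) (⇒*-resolution sts (⇒-Schroder st sX))

  embed : BTree → STree
  embed leaf        = leaf
  embed (bin a l r) = node a (embed l ∷ embed r ∷ [])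

  resolution-embed : ∀ t → resolution (embed t) ≡ t
  resolution-embed leaf        = refl
  resolution-embed (bin a l r) = ≡.cong₂ (bin a) (resolution-embed l) (resolution-embed r)

  arityS-embed : ∀ t → arityS (embed t) ≡ arityB t
  arityS-embed leaf        = refl
  arityS-embed (bin a l r) = ≡.cong₂ _+_ (arityS-embed l) (≡.trans (ℕ.+-identityʳ _) (arityS-embed r))

  embed-Schroder : ∀ t → Schroder (embed t)
  embed-Schroder leaf        = _
  embed-Schroder (bin a l r) = s≤s (s≤s z≤n) , embed-Schroder l , embed-Schroder r , _

  embed-comb : ∀ a xs → 2 ≤ length xs → embed (comb a xs) ⇒* node a (map embed xs)
  embed-comb a (_ ∷ [])         (s≤s ())
  embed-comb a (x ∷ y ∷ [])     _ = ε
  embed-comb a (x ∷ y ∷ z ∷ xs) _ =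
    gmap (λ Y → node a (embed x ∷ Y ∷ [])) (λ st → inside (there (here st)))
         (embed-comb a (y ∷ z ∷ xs) (s≤s (s≤s z≤n))) ◅◅
    subst (λ ys → node a (embed x ∷ node a (map embed (y ∷ z ∷ xs)) ∷ []) ⇒* node a (embed x ∷ ys))
          (List.++-identityʳ _) (contract-≡ (there here) (inj₁ ≼-refl) (↑-idem a) ◅ ε)
    where open IsDecPartialOrder dpo using () renaming (refl to ≼-refl)

  mutual
    embed-resolution : ∀ {X} → Schroder X → embed (resolution X) ⇒* X
    embed-resolution {leaf}      _         = ε
    embed-resolution {node a cs} (2≤ , scs) =
      embed-comb a (resolutions cs) (subst (2 ≤_) (≡.sym (length-resolutions cs)) 2≤) ◅◅
      gmap (node a) inside (embed-resolutions scs)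

    embed-resolutions : ∀ {cs} → SchroderL cs → map embed (resolutions cs) ⇒ᴸ* cs
    embed-resolutions {[]}     _          = ε
    embed-resolutions {c ∷ cs} (sc , scs) =
      gmap _ here (embed-resolution sc) ◅◅ gmap (c ∷_) there (embed-resolutions scs)

  mutual
    arityB-resolution : ∀ {X} → Schroder X → arityB (resolution X) ≡ arityS X
    arityB-resolution {leaf}      _          = refl
    arityB-resolution {node a cs} (2≤ , scs) = arityB-comb a cs (ℕ.≤-trans (s≤s z≤n) 2≤) scs

    arityB-comb : ∀ a cs → 1 ≤ length cs → SchroderL cs → arityB (comb a (resolutions cs)) ≡ arityL cs
    arityB-comb a (c ∷ [])      _ (sc , _)   = ≡.trans (arityB-resolution sc) (≡.sym (ℕ.+-identityʳ _))
    arityB-comb a (c ∷ c′ ∷ cs) _ (sc , scs) =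
      ≡.cong₂ _+_ (arityB-resolution sc) (arityB-comb a (c′ ∷ cs) (s≤s z≤n) scs)

  graftB-outOfRange : ∀ r j t → ¬ j < arityB r → graftB r j t ≡ r
  graftB-outOfRange leaf zero t j≮ = contradiction (s≤s z≤n) j≮
  graftB-outOfRange leaf (suc j) t _ = refl
  graftB-outOfRange (bin a l r) j t j≮ with j <? arityB l
  ... | yes j<l = contradiction (ℕ.<-≤-trans j<l (ℕ.m≤m+n (arityB l) (arityB r))) j≮
  ... | no j≮l  = cong (bin a l) (graftB-outOfRange r (j ∸ arityB l) t (j≮ ∘ m∸n<o⇒m<n+o (ℕ.≮⇒≥ j≮l)))

  embed-graftB : ∀ s i t → embed (graftB s i t) ≡ graftS (embed s) i (embed t)
  embed-graftB leaf zero    t = refl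
  embed-graftB leaf (suc i) t = refl
  embed-graftB (bin a l r) i t with i <? arityB l | i <? arityS (embed l)
  ... | yes _  | yes _  = cong (λ l′ → node a (l′ ∷ embed r ∷ [])) (embed-graftB l i t)
  ... | yes i< | no i≮  = contradiction (subst (i <_) (≡.sym (arityS-embed l)) i<) i≮
  ... | no i≮  | yes i< = contradiction (subst (i <_) (arityS-embed l) i<) i≮
  ... | no _   | no _ rewrite arityS-embed l with i ∸ arityB l <? arityS (embed r)
  ...   | yes _  = cong (λ r′ → node a (embed l ∷ r′ ∷ [])) (embed-graftB r (i ∸ arityB l) t)
  ...   | no j≮r = cong (λ r′ → node a (embed l ∷ embed r′ ∷ []))
                        (graftB-outOfRange r (i ∸ arityB l) t (j≮r ∘ subst (_ <_) (≡.sym (arityS-embed r))))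

module Isomorphism {c ℓ q ℓ'} (K : CommutativeRing c ℓ)
                   (_≼_ : Rel (Fin q) ℓ') (dpo : IsDecPartialOrder _≡_ _≼_)
                   (forest : IsForestPoset _≼_) where
  open Trees q
  open PosetTrees _≼_ dpo
  open Linear K
  open Operads K _≼_ dpo
  open LinearCombinations K
  open Coefficients _≟S_
  module B = Coefficients _≟B_
  module B⇒S = LinearMaps _≟B_ _≟S_
  module S⇒S = LinearMaps _≟S_ _≟S_
  module S⇒B = LinearMaps _≟S_ _≟B_
  open Minimum _≼_ dpo
  open Contraction _≼_ dpo
  open Confluence _≼_ dpo forest
  open Presentation K _≼_ dpo
  open ≡ using (refl; cong; subst)
  open IsDecPartialOrder dpo using () renaming (refl to ≼-refl)

  normalize : BTree → STree
  normalize t = nf (embed t)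

  φ : BTree → Lin STree
  φ t = basis (normalize t)

  normalize-graftB : ∀ s i t → normalize (graftB s i t) ≡ nf (graftS (normalize s) i (normalize t))
  normalize-graftB s i t = ≡.trans (cong nf (embed-graftB s i t)) (nf-graftS (embed s) i (embed t))

  normalize-ASchrBasis : ∀ t → ASchrBasis (arityB t) (normalize t)
  normalize-ASchrBasis t =
    Level.lift (⇒*-Schroder (⇒*-nf (embed t)) (embed-Schroder t)) ,
    nf-Alternating (embed t) ,
    Level.lift (≡.trans (≡.sym (⇒*-arity (⇒*-nf (embed t)))) (arityS-embed t))

  φ-comp : ∀ s i t → φ (graftB s i t) ≋ φ s ∘S[ i ] φ t
  φ-comp s i t = ≋-sym (begin
    φ s ∘S[ i ] φ t                                              ≈⟨ linExt-basis (λ S → linExt (graftNf S) (φ t)) (normalize s) ⟩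
    linExt (graftNf (normalize s)) (φ t)                         ≈⟨ linExt-basis (graftNf (normalize s)) (normalize t) ⟩
    basis (nf (graftS (normalize s) i (normalize t)))            ≡⟨ cong basis (normalize-graftB s i t) ⟨
    φ (graftB s i t)                                             ∎)
    where
    open import Relation.Binary.Reasoning.Setoid ≋-setoid
    graftNf : STree → STree → Lin STree
    graftNf S T = basis (nf (graftS S i T))

  linExt-φ-∘F : ∀ x i y → linExt φ (x ∘F[ i ] y) ≋
                bilinExt (λ s t → basis (nf (graftS (normalize s) i (normalize t)))) x y
  linExt-φ-∘F x i y = ≋-trans (linExt-∘ φ _ x) (linExt-congˡ (λ s →
    ≋-trans (linExt-∘-basis φ (graftB s i) y)
            (linExt-congˡ (λ t → ≋-reflexive (cong basis (normalize-graftB s i t))) y)) x)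

  linExt-φ-precompose : ∀ {U : Set} (_≟U_ : DecidableEquality U) (g : STree → Lin U) x →
                        Coefficients._≋_ _≟U_ (linExt (λ s → g (normalize s)) x) (linExt g (linExt φ x))
  linExt-φ-precompose _≟U_ g x = U.≋-sym (U.linExt-∘-basis g normalize x)
    where module U = Coefficients _≟U_

  normalize-rel₁ : ∀ {a b} → Cmp a b → normalize (bin a (gen b) leaf) ≡ normalize (bin (a ↑ b) leaf (gen (a ↑ b)))
  normalize-rel₁ {a} {b} a~b =
    ≡.trans (nf-⇒* {embed (bin a (gen b) leaf)} (contract-≡ here (swap a~b) (↑-comm (swap a~b)) ◅ ε))
            (≡.sym (nf-⇒* {embed (bin (a ↑ b) leaf (gen (a ↑ b)))}
                          (contract-≡ (there here) (inj₁ ≼-refl) (↑-idem _) ◅ ε)))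

  normalize-rel₂ : ∀ {a b} → Cmp a b → normalize (bin (a ↑ b) (gen (a ↑ b)) leaf) ≡ normalize (bin a leaf (gen b))
  normalize-rel₂ {a} {b} a~b =
    ≡.trans (nf-⇒* {embed (bin (a ↑ b) (gen (a ↑ b)) leaf)} (contract-≡ here (inj₁ ≼-refl) (↑-idem _) ◅ ε))
            (≡.sym (nf-⇒* {embed (bin a leaf (gen b))}
                          (contract-≡ (there here) (swap a~b) (↑-comm (swap a~b)) ◅ ε)))

  linExt-φ-minus-basis : ∀ s t → normalize s ≡ normalize t → linExt φ (basis s -L basis t) ≋ []
  linExt-φ-minus-basis s t s≡t =
    ≋-trans (linExt-minus-basis φ s t) (subst (λ N → φ s -L basis N ≋ []) s≡t (minus-self (φ s)))

  linExt-φ-Ideal : ∀ {n x} → Ideal n x → linExt φ x ≋ []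
  linExt-φ-Ideal (rel₁∈ a b a~b) =
    linExt-φ-minus-basis (bin a (gen b) leaf) (bin (a ↑ b) leaf (gen (a ↑ b))) (normalize-rel₁ a~b)
  linExt-φ-Ideal (rel₂∈ a b a~b) =
    linExt-φ-minus-basis (bin (a ↑ b) (gen (a ↑ b)) leaf) (bin a leaf (gen b)) (normalize-rel₂ a~b)
  linExt-φ-Ideal zero∈ = ≋-refl
  linExt-φ-Ideal (add∈ {x = x} {y} x∈I y∈I) rewrite linExt-++ φ x y =
    ++-cong (linExt-φ-Ideal x∈I) (linExt-φ-Ideal y∈I)
  linExt-φ-Ideal (scale∈ {x = x} k x∈I) = ≋-trans (linExt-• φ k x) (•-cong k (linExt-φ-Ideal x∈I))
  linExt-φ-Ideal (resp∈ {x = x} {y} x≋y x∈I) =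
    ≋-trans (B⇒S.linExt-congʳ φ {y} {x} (B.≋-sym (B.fromEqLin x≋y))) (linExt-φ-Ideal x∈I)
  linExt-φ-Ideal (compL∈ {x = x} y i _ _ x∈I) =
    ≋-trans (linExt-φ-∘F x i y)
      (≋-trans (linExt-φ-precompose _≟S_ Ψ x) (S⇒S.linExt-congʳ Ψ (linExt-φ-Ideal x∈I)))
    where
    Ψ : STree → Lin STree
    Ψ S = linExt (λ t → basis (nf (graftS S i (normalize t)))) y
  linExt-φ-Ideal (compR∈ {y = y} x i _ _ y∈I) =
    ≋-trans (linExt-φ-∘F x i y)
      (≋-trans (linExt-congˡ (λ s → ≋-trans (linExt-φ-precompose _≟S_ (Γ s) y)
                                             (S⇒S.linExt-congʳ (Γ s) (linExt-φ-Ideal y∈I))) x)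
               (≋-reflexive (linExt-const-[] x)))
    where
    Γ : BTree → STree → Lin STree
    Γ s T = basis (nf (graftS (normalize s) i T))

  ∼-resolution-normalize : ∀ t → t ∼ resolution (normalize t)
  ∼-resolution-normalize t = subst (_∼ resolution (normalize t)) (resolution-embed t)
                                   (⇒*-resolution (⇒*-nf (embed t)) (embed-Schroder t))

  -- Modulo the ideal, x = Σ kᵢ tᵢ equals Σ kᵢ resolution (normalize tᵢ), the image of linExt φ x
  -- under a linear map, hence 0.
  linExt-φ-injective : ∀ n x → Supp (ArityB n) x → linExt φ x ≋ [] → Ideal n x
  linExt-φ-injective n x arity φx≋[] = Ideal-resp x-resolved≋x (differences∈I x arity)
    where
    resolve : BTree → BTree
    resolve t = resolution (normalize t)

    differences∈I : ∀ x → Supp (ArityB n) x → Ideal n (linExt (λ t → basis t -L basis (resolve t)) x)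
    differences∈I []            []              = zero∈
    differences∈I ((k , t) ∷ x) (refl ∷ arity) =
      add∈ (scale∈ k (proj₂ (∼-resolution-normalize t))) (differences∈I x arity)

    resolved≋[] : linExt (λ t → basis (resolve t)) x B.≋ []
    resolved≋[] = B.≋-trans (linExt-φ-precompose _≟B_ (λ N → basis (resolution N)) x)
                            (S⇒B.linExt-congʳ (λ N → basis (resolution N)) φx≋[])

    x-resolved≋x : linExt (λ t → basis t -L basis (resolve t)) x B.≋ x
    x-resolved≋x = B.≋-trans (B.linExt-minus-pointwise basis _ x)
                     (subst (λ z → linExt basis x -L linExt (λ t → basis (resolve t)) x B.≋ z) (List.++-identityʳ x)
                        (B.++-cong (B.linExt-basis-id x) (B.•-cong _ resolved≋[])))

  normalize-resolution : ∀ {S} → Schroder S → Alternating S → normalize (resolution S) ≡ S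
  normalize-resolution sS altS = ≡.trans (nf-⇒* (embed-resolution sS)) (nf-Alternating-id altS)

  resolveAll : Lin STree → Lin BTree
  resolveAll = map (map₂ resolution)

  resolveAll-arity : ∀ n y → Supp (ASchrBasis n) y → Supp (ArityB n) (resolveAll y)
  resolveAll-arity n []      []                                  = []
  resolveAll-arity n (_ ∷ y) ((Level.lift sS , _ , Level.lift e) ∷ basic) =
    ≡.trans (arityB-resolution sS) e ∷ resolveAll-arity n y basic

  linExt-φ-resolveAll : ∀ n y → Supp (ASchrBasis n) y → linExt φ (resolveAll y) ≋ y
  linExt-φ-resolveAll n []            []                                  = ≋-refl
  linExt-φ-resolveAll n ((k , S) ∷ y) ((Level.lift sS , altS , _) ∷ basic) rewrite normalize-resolution sS altS =
    ++-cong (•-basis k S) (linExt-φ-resolveAll n y basic)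

  iso : AsIsoASchr
  iso = record
    { φ       = φ
    ; φ-arity = λ t → normalize-ASchrBasis t ∷ []
    ; φ-wd    = λ n x _ x∈I → toEqLin (linExt-φ-Ideal x∈I)
    ; φ-inj   = λ n x arity φx≋[] → linExt-φ-injective n x arity (fromEqLin φx≋[])
    ; φ-surj  = λ n y basic → resolveAll y , resolveAll-arity n y basic , toEqLin (linExt-φ-resolveAll n y basic)
    ; φ-unit  = toEqLin (≋-refl {basis leaf})
    ; φ-comp  = λ s i t _ → toEqLin (φ-comp s i t)
    }

theorem3p10 : ∀ {c ℓ ℓ'} (K : CommutativeRing c ℓ) → IsField K → CharZero K →
              (q : ℕ) (_≼_ : Rel (Fin q) ℓ') (dpo : IsDecPartialOrder _≡_ _≼_) →
              IsForestPoset _≼_ →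
              Operads.AsIsoASchr K _≼_ dpo
theorem3p10 K _ _ _ _≼_ dpo forest = Isomorphism.iso K _≼_ dpo forest
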